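{- Let $\beta=\frac{1+\sqrt5}2$. The set of $F$-expansions of minimal weight in $\{ -1,0,1\}^*$ is equal to the set of $\beta$-expansions of minimal weight in $\{ -1,0,1\}^*$.
   Context: Fibonacci numbers: $F_0=1$, $F_1=2$, $F_n=F_{n-1}+F_{n-2}$ for $n\ge2$. For words $x=x_1\cdots x_n$, $y=y_1\cdots y_m$ over $\mathbb Z$, $x\sim_F y$ means $\sum_{j=1}^n x_jF_{n-j}=\sum_{j=1}^m y_jF_{m-j}$. The weight is $\|x\|=\sum_j|x_j|$. $x$ is $F$-heavy if there is $y\in\mathbb Z^*$ with $x\sim_F y$ and $\|y\|<\|x\|$; otherwise $x$ is an $F$-expansion of minimal weight. Similarly, $x\sim_\beta y$ means $\sum_j x_j\beta^{ -j}=\beta^k\sum_j y_j\beta^{ -j}$ for some $k\in\mathbb Z$, $x$ is $\beta$-heavy if some $y\in\mathbb Z^*$ with $x\sim_\beta y$ has $\|y\|<\|x\|$, and otherwise $x$ is a $\beta$-expansion of minimal weight. -}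

module Defs where

open import Data.Nat using (ℕ; zero; suc; _<_)
import Data.Nat as ℕ
open import Data.Integer using (ℤ; +_; -[1+_]; _+_; _*_; ∣_∣)
open import Data.List using (List; []; _∷_; length)
open import Data.List.Relation.Unary.All using (All)
open import Data.Product using (_×_; _,_; ∃; ∃-syntax)
open import Data.Sum using (_⊎_)
open import Relation.Binary.PropositionalEquality using (_≡_)
open import Relation.Nullary using (¬_)

-- Words over ℤ are lists; the first list element is x₁.
Word : Set
Word = List ℤ

F : ℕ → ℤ
F 0 = + 1
F 1 = + 2
F (suc (suc n)) = F (suc n) + F n

fval : Word → ℤ
fval [] = + 0
fval (x ∷ xs) = x * F (length xs) + fval xs

weight : Word → ℕ
weight [] = 0
weight (x ∷ xs) = ∣ x ∣ ℕ.+ weight xs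

_∼F_ : Word → Word → Set
x ∼F y = fval x ≡ fval y

F-heavy : Word → Set
F-heavy x = ∃[ y ] (x ∼F y × weight y < weight x)

F-minimal : Word → Set
F-minimal x = ¬ F-heavy x

-- The ring ℤ[β], β = (1+√5)/2, β² = β + 1; the pair (a , b) stands for a + bβ.
-- (Since β is irrational, this representation is faithful: a + bβ = 0 iff a = b = 0.)
Zβ : Set
Zβ = ℤ × ℤ

_⊕_ : Zβ → Zβ → Zβ
(a , b) ⊕ (c , d) = (a + c , b + d)

-- multiplication by β : (a + bβ)β = b + (a+b)β
mulβ : Zβ → Zβ
mulβ (a , b) = (b , a + b)

mulβ^ : ℕ → Zβ → Zβ
mulβ^ zero v = v
mulβ^ (suc n) v = mulβ (mulβ^ n v)

ι : ℤ → Zβ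
ι a = (a , + 0)

-- Σ_j x_j β^{n-j}  (= β^n · Σ_j x_j β^{-j})
βval : Word → Zβ
βval [] = ι (+ 0)
βval (x ∷ xs) = mulβ^ (length xs) (ι x) ⊕ βval xs

-- x ∼β y  iff  Σ x_j β^{-j} = β^k Σ y_j β^{-j} for some k ∈ ℤ.
-- Equivalently βval x = β^t βval y for some t ∈ ℤ, i.e. β^p βval x = β^q βval y
-- for some p q ∈ ℕ (β is a unit).
_∼β_ : Word → Word → Set
x ∼β y = ∃[ p ] ∃[ q ] (mulβ^ p (βval x) ≡ mulβ^ q (βval y))

β-heavy : Word → Set
β-heavy x = ∃[ y ] (x ∼β y × weight y < weight x)

β-minimal : Word → Set
β-minimal x = ¬ β-heavy x

IsDigit : ℤ → Set
IsDigit d = (d ≡ -[1+ 0 ]) ⊎ (d ≡ + 0) ⊎ (d ≡ + 1)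

Ternary : Word → Set
Ternary x = All IsDigit x

module Submission where

-- Let minWeight be given by minWeight (F_{j+1} + a) = 1 + min (minWeight a) (minWeight b) whenever
-- a + b = F_j.  It changes by at most one when some ±F_k is added, so weight y ≥ minWeight |fval y|
-- for every word y.  For words over {−1, 0, 1} both kinds of minimality are equivalent to avoiding a
-- list of forbidden factors.  A forbidden factor can be rewritten into a lighter word with the same
-- F-value and, if a 0 follows it, the same β-value; so it makes a word F-heavy and β-heavy.
-- Conversely, a forbidden-free word x has weight x ≤ minWeight |fval x|, by induction on its length
-- with a case split on the digits after its leading ±1; hence it is F-minimal.  It is also β-minimal,
-- because a lighter y with β^p x = β^q y would give x 0^p and y 0^q equal β-values and hence equal
-- F-values, while x 0^p is still forbidden-free.

open import Defs
open import Data.Product using (_×_; _,_)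

module Fibonacci where
  open import Data.Nat
  open import Data.Nat.Properties
  open import Data.Sum using (inj₁; inj₂)
  open import Relation.Nullary using (yes; no; contradiction)
  open import Relation.Binary.PropositionalEquality

  fib : ℕ → ℕ
  fib 0 = 1
  fib 1 = 2
  fib (suc (suc n)) = fib (suc n) + fib n

  0<fib : ∀ n → 0 < fib n
  0<fib 0 = s≤s z≤n
  0<fib 1 = s≤s z≤n
  0<fib (suc (suc n)) = ≤-trans (0<fib (suc n)) (m≤m+n (fib (suc n)) (fib n))

  fib-<-suc : ∀ n → fib n < fib (suc n)
  fib-<-suc 0 = s≤s (s≤s z≤n)
  fib-<-suc (suc n) = subst (_≤ fib (suc n) + fib n) (+-comm (fib (suc n)) 1) (+-monoʳ-≤ (fib (suc n)) (0<fib n))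

  fib-mono-< : ∀ {m n} → m < n → fib m < fib n
  fib-mono-< {m} {suc n} (s≤s m≤n) with m≤n⇒m<n∨m≡n m≤n
  ... | inj₁ m<n = <-trans (fib-mono-< m<n) (fib-<-suc n)
  ... | inj₂ refl = fib-<-suc m

  fib-mono-≤ : ∀ {m n} → m ≤ n → fib m ≤ fib n
  fib-mono-≤ m≤n with m≤n⇒m<n∨m≡n m≤n
  ... | inj₁ m<n = <⇒≤ (fib-mono-< m<n)
  ... | inj₂ refl = ≤-refl

  fib-cancel-< : ∀ {m n} → fib m < fib n → m < n
  fib-cancel-< {m} {n} h with m <? n
  ... | yes m<n = m<n
  ... | no m≮n = contradiction (fib-mono-≤ (≮⇒≥ m≮n)) (<⇒≱ h)

  n<fib : ∀ n → n < fib n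
  n<fib 0 = s≤s z≤n
  n<fib (suc n) = ≤-trans (s≤s (n<fib n)) (fib-<-suc n)

  fib-+-fib≤fib-suc-suc : ∀ k p → fib (suc p) + fib (suc p) ≤ fib (suc (suc (k + suc p)))
  fib-+-fib≤fib-suc-suc k p =
    ≤-trans (+-monoˡ-≤ (fib (suc p)) (<⇒≤ (fib-<-suc (suc p)))) (fib-mono-≤ (s≤s (s≤s (m≤n+m (suc p) k))))


module MinimalWeight where
  open import Data.Nat
  open import Data.Nat.Properties
  open import Data.Sum using (inj₁; inj₂)
  open import Relation.Nullary using (yes; no; contradiction)
  open import Relation.Binary.PropositionalEquality
  open Fibonacci

  -- Meaningful for M ≤ F_{j+1}: if F_j ≤ M, one digit goes to F_j (leaving M − F_j) or to F_{j+1}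
  -- (leaving F_{j+1} − M).
  minWeightUpTo : ℕ → ℕ → ℕ
  minWeightUpTo zero zero = 0
  minWeightUpTo zero (suc _) = 1
  minWeightUpTo (suc j) M with fib (suc j) ≤? M
  ... | yes _ = suc (minWeightUpTo j (M ∸ fib (suc j)) ⊓ minWeightUpTo j (fib (suc (suc j)) ∸ M))
  ... | no _ = minWeightUpTo j M

  minWeight : ℕ → ℕ
  minWeight M = minWeightUpTo M M

  minWeightUpTo-< : ∀ j M → M < fib (suc j) → minWeightUpTo (suc j) M ≡ minWeightUpTo j M
  minWeightUpTo-< j M h with fib (suc j) ≤? M
  ... | yes h′ = contradiction h′ (<⇒≱ h)
  ... | no _ = refl

  minWeightUpTo-≥ : ∀ j M → fib (suc j) ≤ M →
    minWeightUpTo (suc j) M ≡ suc (minWeightUpTo j (M ∸ fib (suc j)) ⊓ minWeightUpTo j (fib (suc (suc j)) ∸ M))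
  minWeightUpTo-≥ j M h with fib (suc j) ≤? M
  ... | yes _ = refl
  ... | no h′ = contradiction h h′

  minWeightUpTo-0 : ∀ j → minWeightUpTo j 0 ≡ 0
  minWeightUpTo-0 zero = refl
  minWeightUpTo-0 (suc j) = trans (minWeightUpTo-< j 0 (0<fib (suc j))) (minWeightUpTo-0 j)

  minWeightUpTo-fib : ∀ j → minWeightUpTo j (fib j) ≡ 1
  minWeightUpTo-fib zero = refl
  minWeightUpTo-fib (suc j)
    rewrite minWeightUpTo-≥ j (fib (suc j)) ≤-refl | n∸n≡0 (fib (suc j)) | minWeightUpTo-0 j = refl

  minWeightUpTo-fib-suc : ∀ j → minWeightUpTo j (fib (suc j)) ≡ 1
  minWeightUpTo-fib-suc zero = refl
  minWeightUpTo-fib-suc (suc j)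
    rewrite minWeightUpTo-≥ j (fib (suc (suc j))) (<⇒≤ (fib-<-suc (suc j))) | n∸n≡0 (fib (suc (suc j)))
          | minWeightUpTo-0 j | ⊓-zeroʳ (minWeightUpTo j (fib (suc (suc j)) ∸ fib (suc j))) = refl

  minWeightUpTo-suc : ∀ j M → M ≤ fib (suc j) → minWeightUpTo (suc j) M ≡ minWeightUpTo j M
  minWeightUpTo-suc j M h with m≤n⇒m<n∨m≡n h
  ... | inj₁ lt = minWeightUpTo-< j M lt
  ... | inj₂ refl
    rewrite minWeightUpTo-≥ j (fib (suc j)) ≤-refl | n∸n≡0 (fib (suc j)) | minWeightUpTo-0 j
          | minWeightUpTo-fib-suc j = refl

  minWeightUpTo-stable : ∀ j d M → M ≤ fib (suc j) → minWeightUpTo (d + j) M ≡ minWeightUpTo j M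
  minWeightUpTo-stable j zero M h = refl
  minWeightUpTo-stable j (suc d) M h =
    trans (minWeightUpTo-suc (d + j) M (≤-trans h (fib-mono-≤ (s≤s (m≤n+m j d))))) (minWeightUpTo-stable j d M h)

  minWeight≡minWeightUpTo : ∀ j M → M ≤ fib (suc j) → minWeight M ≡ minWeightUpTo j M
  minWeight≡minWeightUpTo j M h = begin
      minWeightUpTo M M       ≡⟨ minWeightUpTo-stable M j M (<⇒≤ (<-trans (n<fib M) (fib-<-suc M))) ⟨
      minWeightUpTo (j + M) M ≡⟨ cong (λ z → minWeightUpTo z M) (+-comm j M) ⟩
      minWeightUpTo (M + j) M ≡⟨ minWeightUpTo-stable j M M h ⟩
      minWeightUpTo j M       ∎
    where open ≡-Reasoning

  minWeight-fib : ∀ k → minWeight (fib k) ≡ 1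
  minWeight-fib k = trans (minWeight≡minWeightUpTo k (fib k) (<⇒≤ (fib-<-suc k))) (minWeightUpTo-fib k)

  minWeight-split : ∀ j M a b → fib j + a ≡ M → M + b ≡ fib (suc j) → minWeight M ≡ suc (minWeight a ⊓ minWeight b)
  minWeight-split zero _ zero b refl _ = refl
  minWeight-split zero _ (suc zero) zero refl _ = refl
  minWeight-split zero _ (suc zero) (suc b) refl ()
  minWeight-split zero _ (suc (suc a)) b refl ()
  minWeight-split (suc j) .(fib (suc j) + a) a b refl M+b≡F = begin
      minWeight (fib (suc j) + a)
        ≡⟨ minWeight≡minWeightUpTo (suc j) _ (subst (fib (suc j) + a ≤_) M+b≡F (m≤m+n _ b)) ⟩
      minWeightUpTo (suc j) (fib (suc j) + a)
        ≡⟨ minWeightUpTo-≥ j _ (m≤m+n _ a) ⟩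
      suc (minWeightUpTo j (fib (suc j) + a ∸ fib (suc j)) ⊓ minWeightUpTo j (fib (suc (suc j)) ∸ (fib (suc j) + a)))
        ≡⟨ cong₂ (λ u v → suc (minWeightUpTo j u ⊓ minWeightUpTo j v)) (m+n∸m≡n (fib (suc j)) a) F∸M≡b ⟩
      suc (minWeightUpTo j a ⊓ minWeightUpTo j b)
        ≡⟨ cong₂ (λ u v → suc (u ⊓ v)) (minWeight≡minWeightUpTo j a a≤F) (minWeight≡minWeightUpTo j b b≤F) ⟨
      suc (minWeight a ⊓ minWeight b) ∎
    where
    open ≡-Reasoning
    a+b≡F : a + b ≡ fib j
    a+b≡F = +-cancelˡ-≡ (fib (suc j)) (a + b) (fib j) (trans (sym (+-assoc (fib (suc j)) a b)) M+b≡F)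
    F∸M≡b : fib (suc (suc j)) ∸ (fib (suc j) + a) ≡ b
    F∸M≡b = trans (cong (_∸ (fib (suc j) + a)) (sym M+b≡F)) (m+n∸m≡n (fib (suc j) + a) b)
    a≤F : a ≤ fib (suc j)
    a≤F = ≤-trans (subst (a ≤_) a+b≡F (m≤m+n a b)) (<⇒≤ (fib-<-suc j))
    b≤F : b ≤ fib (suc j)
    b≤F = ≤-trans (subst (b ≤_) a+b≡F (m≤n+m b a)) (<⇒≤ (fib-<-suc j))


module Lipschitz where
  open import Data.Nat
  open import Data.Nat.Properties
  open import Data.Nat.Tactic.RingSolver
  open import Data.Nat.Induction using (<-rec)
  open import Data.Product using (_×_; _,_; ∃; proj₁; proj₂)
  open import Data.Sum using (inj₁; inj₂)
  open import Data.Empty using (⊥-elim)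
  open import Relation.Nullary using (yes; no)
  open import Relation.Binary using (tri<; tri≈; tri>)
  open import Relation.Binary.PropositionalEquality
  open Fibonacci
  open MinimalWeight

  record FibLipschitz (N : ℕ) : Set where
    field
      add         : ∀ k → minWeight (N + fib k) ≤ suc (minWeight N)
      sub         : ∀ k M → M + fib k ≡ N → minWeight M ≤ suc (minWeight N)
      complement  : ∀ k M → N + M ≡ fib k → minWeight M ≤ suc (minWeight N)
      complement′ : ∀ k M → N + M ≡ fib k → minWeight N ≤ suc (minWeight M)
  open FibLipschitz public

  difference : ∀ {m n} → m ≤ n → ∃ λ c → m + c ≡ n
  difference m≤n = m≤n⇒∃[o]m+o≡n m≤n

  ≤-suc-trans : ∀ {x y z} → x ≤ suc y → y ≤ suc z → x ≤ suc (suc z)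
  ≤-suc-trans x≤1+y y≤1+z = ≤-trans x≤1+y (s≤s y≤1+z)

  ≤-+⊓ : ∀ c {x p q} → x ≤ c + p → x ≤ c + q → x ≤ c + (p ⊓ q)
  ≤-+⊓ c {x} {p} {q} x≤c+p x≤c+q = subst (x ≤_) (sym (+-distribˡ-⊓ c p q)) (⊓-glb x≤c+p x≤c+q)

  ≤-suc-minWeight-split : ∀ {x} N a b → minWeight N ≡ suc (minWeight a ⊓ minWeight b) →
    x ≤ suc (suc (minWeight a)) → x ≤ suc (suc (minWeight b)) → x ≤ suc (minWeight N)
  ≤-suc-minWeight-split N a b eq h₁ h₂ rewrite eq = ≤-+⊓ 2 h₁ h₂

  ≡suc⊓⇒≤ˡ : ∀ {x a b} → x ≡ suc (a ⊓ b) → x ≤ suc a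
  ≡suc⊓⇒≤ˡ {a = a} {b} refl = s≤s (m⊓n≤m a b)

  ≡suc⊓⇒≤ʳ : ∀ {x a b} → x ≡ suc (a ⊓ b) → x ≤ suc b
  ≡suc⊓⇒≤ʳ {a = a} {b} refl = s≤s (m⊓n≤n a b)

  ≤-suc-suc : ∀ {m n} → m ≤ n → m ≤ suc (suc n)
  ≤-suc-suc m≤n = ≤-trans m≤n (≤-trans (n≤1+n _) (n≤1+n _))

  lipschitz-0 : FibLipschitz 0
  add lipschitz-0 k = ≤-reflexive (minWeight-fib k)
  sub lipschitz-0 k M eq = ⊥-elim (<⇒≱ (≤-trans (0<fib k) (m≤n+m (fib k) M)) (≤-reflexive eq))
  complement lipschitz-0 k M refl = ≤-reflexive (minWeight-fib k)
  complement′ lipschitz-0 k M eq = z≤n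

  lipschitz-1 : FibLipschitz 1
  add lipschitz-1 k = ≡suc⊓⇒≤ˡ (minWeight-split k (1 + fib k) 1 (proj₁ d) (+-comm (fib k) 1) (proj₂ d))
    where d = difference (fib-<-suc k)
  sub lipschitz-1 k zero eq = z≤n
  sub lipschitz-1 k (suc M) eq = ⊥-elim (<⇒≱ (s≤s (≤-trans (0<fib k) (m≤n+m (fib k) M))) (≤-reflexive eq))
  complement lipschitz-1 zero zero eq = z≤n
  complement lipschitz-1 zero (suc M) ()
  complement lipschitz-1 (suc k) M eq = ≡suc⊓⇒≤ʳ (minWeight-split k M (proj₁ d) 1 (proj₂ d) (trans (+-comm M 1) eq))
    where
    F≤M : fib k ≤ M
    F≤M = +-cancelˡ-≤ 1 _ _ (subst (1 + fib k ≤_) (sym eq) (fib-<-suc k))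
    d = difference F≤M
  complement′ lipschitz-1 k M eq = s≤s z≤n

  add-leading : ∀ i a b → a + b ≡ fib i → (∀ M → M < fib (suc i) + a → FibLipschitz M) →
    minWeight ((fib (suc i) + a) + fib (suc i)) ≤ suc (minWeight (fib (suc i) + a))
  add-leading zero zero .1 refl IH = s≤s (s≤s z≤n)
  add-leading zero (suc zero) .0 refl IH = s≤s z≤n
  add-leading zero (suc (suc a)) b () IH
  add-leading (suc h) a b a+b≡F IH =
    ≤-suc-minWeight-split N a b minWeightN
      (≤-trans (≡suc⊓⇒≤ˡ minWeightM)
               (s≤s (subst (λ z → minWeight z ≤ suc (minWeight a)) (+-comm a (fib h)) (add (IH a a<N) h))))
      (≤-trans (≡suc⊓⇒≤ʳ minWeightM) (n≤1+n _))
    where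
    N = fib (suc (suc h)) + a
    N+b≡F : N + b ≡ fib (suc (suc (suc h)))
    N+b≡F = trans (+-assoc (fib (suc (suc h))) a b) (cong (fib (suc (suc h)) +_) a+b≡F)
    minWeightN : minWeight N ≡ suc (minWeight a ⊓ minWeight b)
    minWeightN = minWeight-split (suc (suc h)) N a b refl N+b≡F
    a<N : a < N
    a<N = +-monoˡ-≤ a (0<fib (suc (suc h)))
    M = N + fib (suc (suc h))
    F+[F+a]≡M : fib (suc (suc (suc h))) + (fib h + a) ≡ M
    F+[F+a]≡M = lemma (fib (suc h)) (fib h) a
      where
      lemma : ∀ x y a → ((x + y) + x) + (y + a) ≡ (x + y) + a + (x + y)
      lemma = solve-∀
    M+b≡F : M + b ≡ fib (suc (suc (suc (suc h))))
    M+b≡F = trans (lemma N (fib (suc (suc h))) b) (cong (_+ fib (suc (suc h))) N+b≡F)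
      where
      lemma : ∀ x y z → x + y + z ≡ x + z + y
      lemma = solve-∀
    minWeightM : minWeight M ≡ suc (minWeight (fib h + a) ⊓ minWeight b)
    minWeightM = minWeight-split (suc (suc (suc h))) M (fib h + a) b F+[F+a]≡M M+b≡F

  -- N = F_{i+1} + a with a + b = F_i, so minWeight N = 1 + min (minWeight a) (minWeight b);
  -- every bound for N follows from that split and the bounds below N.
  module InductiveStep (i a b : ℕ) (a+b≡F : a + b ≡ fib i) (IH : ∀ M → M < fib (suc i) + a → FibLipschitz M) where
    N : ℕ
    N = fib (suc i) + a
    N+b≡F : N + b ≡ fib (suc (suc i))
    N+b≡F = trans (+-assoc (fib (suc i)) a b) (cong (fib (suc i) +_) a+b≡F)
    minWeightN : minWeight N ≡ suc (minWeight a ⊓ minWeight b)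
    minWeightN = minWeight-split (suc i) N a b refl N+b≡F
    b≤F : b ≤ fib i
    b≤F = subst (b ≤_) a+b≡F (m≤n+m b a)
    fib-suc≤N : fib (suc i) ≤ N
    fib-suc≤N = m≤m+n (fib (suc i)) a
    fib<N : fib i < N
    fib<N = <-≤-trans (fib-<-suc i) fib-suc≤N
    a<N : a < N
    a<N = +-monoˡ-≤ a (0<fib (suc i))
    b<N : b < N
    b<N = ≤-<-trans b≤F fib<N
    N≤fib : N ≤ fib (suc (suc i))
    N≤fib = subst (N ≤_) N+b≡F (m≤m+n N b)

    add-below : ∀ k → k < suc i → minWeight (N + fib k) ≤ suc (minWeight N)
    add-below k k<1+i = ≤-suc-minWeight-split N a b minWeightN via-a via-b
      where
      F≤F : fib k ≤ fib i
      F≤F = fib-mono-≤ (≤-pred k<1+i)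
      via-a : minWeight (N + fib k) ≤ suc (suc (minWeight a))
      via-a = subst (λ z → minWeight z ≤ suc (suc (minWeight a)))
                (sym (trans (+-assoc (fib (suc i)) a (fib k)) (+-comm (fib (suc i)) (a + fib k))))
                (≤-suc-trans (add (IH (a + fib k) a+F<N) (suc i)) (add (IH a a<N) k))
        where
        a+F<N : a + fib k < N
        a+F<N = subst (a + fib k <_) (+-comm a (fib (suc i))) (+-monoʳ-< a (fib-mono-< k<1+i))
      via-b : minWeight (N + fib k) ≤ suc (suc (minWeight b))
      via-b with ≤-total b (fib k)
      ... | inj₁ b≤F′ = subst (λ z → minWeight z ≤ suc (suc (minWeight b))) c+F≡N+F
                          (≤-suc-trans (add (IH c (≤-<-trans c≤F (≤-<-trans F≤F fib<N))) (suc (suc i)))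
                                       (complement (IH b b<N) k c (proj₂ d)))
        where
        d = difference b≤F′
        c = proj₁ d
        c≤F : c ≤ fib k
        c≤F = subst (c ≤_) (proj₂ d) (m≤n+m c b)
        c+F≡N+F : c + fib (suc (suc i)) ≡ N + fib k
        c+F≡N+F = begin
          c + fib (suc (suc i)) ≡⟨ cong (c +_) N+b≡F ⟨
          c + (N + b)           ≡⟨ +-comm c (N + b) ⟩
          (N + b) + c           ≡⟨ +-assoc N b c ⟩
          N + (b + c)           ≡⟨ cong (N +_) (proj₂ d) ⟩
          N + fib k             ∎
          where open ≡-Reasoning
      ... | inj₂ F≤b = ≤-suc-trans (complement (IH c (≤-<-trans c≤b b<N)) (suc (suc i)) (N + fib k) c+N+F≡F)
                                   (sub (IH b b<N) k c (trans (+-comm c (fib k)) (proj₂ d)))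
        where
        d = difference F≤b
        c = proj₁ d
        c≤b : c ≤ b
        c≤b = subst (c ≤_) (proj₂ d) (m≤n+m c (fib k))
        c+N+F≡F : c + (N + fib k) ≡ fib (suc (suc i))
        c+N+F≡F = begin
          c + (N + fib k) ≡⟨ trans (+-comm c (N + fib k)) (+-assoc N (fib k) c) ⟩
          N + (fib k + c) ≡⟨ cong (N +_) (proj₂ d) ⟩
          N + b           ≡⟨ N+b≡F ⟩
          fib (suc (suc i)) ∎
          where open ≡-Reasoning

    add-next : minWeight (N + fib (suc (suc i))) ≤ suc (minWeight N)
    add-next = ≤-suc-minWeight-split N a b minWeightN
      (≤-trans (≡suc⊓⇒≤ˡ minWeightM) (n≤1+n _))
      (≤-trans (≡suc⊓⇒≤ʳ minWeightM)
               (s≤s (subst (λ z → minWeight z ≤ suc (minWeight b)) (+-comm b (fib (suc i))) (add (IH b b<N) (suc i)))))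
      where
      M = N + fib (suc (suc i))
      F+a≡M : fib (suc (suc (suc i))) + a ≡ M
      F+a≡M = lemma (fib (suc i)) (fib i) a
        where
        lemma : ∀ x y a → ((x + y) + x) + a ≡ x + a + (x + y)
        lemma = solve-∀
      M+F+b≡F : M + (fib (suc i) + b) ≡ fib (suc (suc (suc (suc i))))
      M+F+b≡F = begin
        M + (fib (suc i) + b)                              ≡⟨ lemma N (fib (suc (suc i))) (fib (suc i)) b ⟩
        (N + b) + fib (suc (suc i)) + fib (suc i)          ≡⟨ cong (λ z → z + fib (suc (suc i)) + fib (suc i)) N+b≡F ⟩
        fib (suc (suc i)) + fib (suc (suc i)) + fib (suc i) ≡⟨ +-assoc (fib (suc (suc i))) (fib (suc (suc i))) (fib (suc i)) ⟩
        fib (suc (suc i)) + fib (suc (suc (suc i)))         ≡⟨ +-comm (fib (suc (suc i))) _ ⟩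
        fib (suc (suc (suc (suc i))))                       ∎
        where
        open ≡-Reasoning
        lemma : ∀ x y z w → x + y + (z + w) ≡ x + w + y + z
        lemma = solve-∀
      minWeightM : minWeight M ≡ suc (minWeight a ⊓ minWeight (fib (suc i) + b))
      minWeightM = minWeight-split (suc (suc (suc i))) M a (fib (suc i) + b) F+a≡M M+F+b≡F

    -- For k ≥ i + 3 the number N + F_k lies between F_k and F_{k+1}, with N as its lower part.
    add-far : ∀ k → suc (suc i) < k → minWeight (N + fib k) ≤ suc (minWeight N)
    add-far (suc (suc k)) (s≤s (s≤s 1+i≤k)) = ≡suc⊓⇒≤ˡ minWeightM
      where
      d = difference (≤-trans N≤fib (fib-mono-≤ (s≤s 1+i≤k)))
      c = proj₁ d
      M = N + fib (suc (suc k))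
      M+c≡F : M + c ≡ fib (suc (suc (suc k)))
      M+c≡F = trans (lemma N (fib (suc (suc k))) c) (cong (fib (suc (suc k)) +_) (proj₂ d))
        where
        lemma : ∀ x y z → x + y + z ≡ y + (x + z)
        lemma = solve-∀
      minWeightM : minWeight M ≡ suc (minWeight N ⊓ minWeight c)
      minWeightM = minWeight-split (suc (suc k)) M N c (+-comm (fib (suc (suc k))) N) M+c≡F

    addN : ∀ k → minWeight (N + fib k) ≤ suc (minWeight N)
    addN k with <-cmp k (suc i)
    ... | tri< k<1+i _ _ = add-below k k<1+i
    ... | tri≈ _ refl _ = add-leading i a b a+b≡F IH
    ... | tri> _ _ 1+i<k with m≤n⇒m<n∨m≡n 1+i<k
    ...   | inj₁ 2+i<k = add-far k 2+i<k
    ...   | inj₂ refl = add-next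

    sub-below : ∀ k M → k < suc i → M + fib k ≡ N → minWeight M ≤ suc (minWeight N)
    sub-below k M k<1+i M+F≡N = ≤-suc-minWeight-split N a b minWeightN via-a via-b
      where
      F≤F : fib k ≤ fib i
      F≤F = fib-mono-≤ (≤-pred k<1+i)
      M<N : M < N
      M<N = subst (M <_) M+F≡N (subst (_≤ M + fib k) (+-comm M 1) (+-monoʳ-≤ M (0<fib k)))
      via-a : minWeight M ≤ suc (suc (minWeight a))
      via-a with ≤-total (fib k) a
      ... | inj₁ F≤a = subst (λ z → minWeight z ≤ suc (suc (minWeight a))) (sym M≡c+F)
                         (≤-suc-trans (add (IH c (≤-<-trans c≤a a<N)) (suc i))
                                      (sub (IH a a<N) k c (trans (+-comm c (fib k)) (proj₂ d))))
        where
        d = difference F≤a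
        c = proj₁ d
        c≤a : c ≤ a
        c≤a = subst (c ≤_) (proj₂ d) (m≤n+m c (fib k))
        M≡c+F : M ≡ c + fib (suc i)
        M≡c+F = +-cancelʳ-≡ (fib k) M (c + fib (suc i)) (trans M+F≡N (lemma (fib (suc i)) (fib k) c a (proj₂ d)))
          where
          lemma : ∀ x y c a → y + c ≡ a → x + a ≡ c + x + y
          lemma x y c a refl = rearrange x y c
            where
            rearrange : ∀ x y c → x + (y + c) ≡ c + x + y
            rearrange = solve-∀
      ... | inj₂ a≤F = ≤-suc-trans (complement (IH c (≤-<-trans c≤F (≤-<-trans F≤F fib<N))) (suc i) M (trans (+-comm c M) M+c≡F))
                                   (complement (IH a a<N) k c (proj₂ d))
        where
        d = difference a≤F
        c = proj₁ d
        c≤F : c ≤ fib k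
        c≤F = subst (c ≤_) (proj₂ d) (m≤n+m c a)
        M+c≡F : M + c ≡ fib (suc i)
        M+c≡F = +-cancelʳ-≡ a (M + c) (fib (suc i)) (lemma M (fib k) (fib (suc i)) a c M+F≡N (proj₂ d))
          where
          lemma : ∀ M y x a c → M + y ≡ x + a → a + c ≡ y → M + c + a ≡ x + a
          lemma M y x a c eq refl = trans (rearrange M a c) eq
            where
            rearrange : ∀ M a c → M + c + a ≡ M + (a + c)
            rearrange = solve-∀
      via-b : minWeight M ≤ suc (suc (minWeight b))
      via-b = ≤-suc-trans (complement′ (IH M M<N) (suc (suc i)) (b + fib k) M+b+F≡F) (add (IH b b<N) k)
        where
        M+b+F≡F : M + (b + fib k) ≡ fib (suc (suc i))
        M+b+F≡F = trans (lemma M b (fib k)) (trans (cong (_+ b) M+F≡N) N+b≡F)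
          where
          lemma : ∀ M b y → M + (b + y) ≡ M + y + b
          lemma = solve-∀

    sub-leading : ∀ M → M + fib (suc i) ≡ N → minWeight M ≤ suc (minWeight N)
    sub-leading M M+F≡N = subst (λ z → minWeight z ≤ suc (minWeight N)) (sym M≡a)
      (≤-suc-minWeight-split N a b minWeightN (≤-suc-suc ≤-refl)
        (≤-trans (complement (IH b b<N) i a (trans (+-comm b a) a+b≡F)) (n≤1+n _)))
      where
      M≡a : M ≡ a
      M≡a = +-cancelʳ-≡ (fib (suc i)) M a (trans M+F≡N (+-comm (fib (suc i)) a))

    sub-above : ∀ k M → suc i < k → M + fib k ≡ N → minWeight M ≤ suc (minWeight N)
    sub-above k zero 1+i<k M+F≡N = z≤n
    sub-above k (suc M) 1+i<k M+F≡N =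
      ⊥-elim (<⇒≱ (subst (fib k <_) M+F≡N (m<n+m (fib k) (s≤s z≤n))) (≤-trans N≤fib (fib-mono-≤ 1+i<k)))

    subN : ∀ k M → M + fib k ≡ N → minWeight M ≤ suc (minWeight N)
    subN k M M+F≡N with <-cmp k (suc i)
    ... | tri< k<1+i _ _ = sub-below k M k<1+i M+F≡N
    ... | tri≈ _ refl _ = sub-leading M M+F≡N
    ... | tri> _ _ 1+i<k = sub-above k M 1+i<k M+F≡N

    Complement : ℕ → Set
    Complement M = (minWeight M ≤ suc (minWeight N)) × (minWeight N ≤ suc (minWeight M))

    complement-leading : ∀ M → N + M ≡ fib (suc i) → Complement M
    complement-leading M N+M≡F = subst (λ z → minWeight z ≤ suc (minWeight N)) (sym M≡0) z≤n
                               , ≤-trans (≡suc⊓⇒≤ˡ minWeightN) (s≤s (subst (λ z → minWeight z ≤ minWeight M) (sym a≡0) z≤n))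
      where
      a+M≡0 : a + M ≡ 0
      a+M≡0 = +-cancelˡ-≡ (fib (suc i)) (a + M) 0
                (trans (sym (+-assoc (fib (suc i)) a M)) (trans N+M≡F (sym (+-identityʳ (fib (suc i))))))
      a≡0 : a ≡ 0
      a≡0 = m+n≡0⇒m≡0 a a+M≡0
      M≡0 : M ≡ 0
      M≡0 = m+n≡0⇒n≡0 a a+M≡0

    complement-next : ∀ M → N + M ≡ fib (suc (suc i)) → Complement M
    complement-next M N+M≡F =
        subst (λ z → minWeight z ≤ suc (minWeight N)) (sym M≡b)
          (≤-suc-minWeight-split N a b minWeightN (≤-trans (complement (IH a a<N) i b a+b≡F) (n≤1+n _)) (≤-suc-suc ≤-refl))
      , subst (λ z → minWeight N ≤ suc (minWeight z)) (sym M≡b) (≡suc⊓⇒≤ʳ minWeightN)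
      where
      M≡b : M ≡ b
      M≡b = +-cancelˡ-≡ N M b (trans N+M≡F (sym N+b≡F))

    -- The only k ≥ i + 3 with N ≰ F_{k−2} is k = i + 3, where M = F_{i+1} + b mirrors N.
    complement-mirror : ∀ M → N + M ≡ fib (suc (suc (suc i))) → Complement M
    complement-mirror M N+M≡F = m≤n⇒m≤1+n (≤-reflexive WM≡WN) , m≤n⇒m≤1+n (≤-reflexive (sym WM≡WN))
      where
      M≡F+b : M ≡ fib (suc i) + b
      M≡F+b = trans (+-cancelˡ-≡ N M (b + fib (suc i))
                       (trans N+M≡F (trans (cong (_+ fib (suc i)) (sym N+b≡F)) (+-assoc N b (fib (suc i))))))
                    (+-comm b (fib (suc i)))
      M+a≡F : M + a ≡ fib (suc (suc i))
      M+a≡F = trans (cong (_+ a) M≡F+b) (trans (+-assoc (fib (suc i)) b a) (cong (fib (suc i) +_) (trans (+-comm b a) a+b≡F)))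
      WM≡WN : minWeight M ≡ minWeight N
      WM≡WN = trans (minWeight-split (suc i) M b a (sym M≡F+b) M+a≡F)
                (trans (cong suc (⊓-comm (minWeight b) (minWeight a))) (sym minWeightN))

    complementN : ∀ k M → N + M ≡ fib k → Complement M
    complement-above : ∀ k → suc i < k → ∀ M → N + M ≡ fib k → Complement M

    complementN k M N+M≡F with <-cmp k (suc i)
    ... | tri< k<1+i _ _ = ⊥-elim (<⇒≱ (<-≤-trans (fib-mono-< k<1+i) fib-suc≤N) (subst (N ≤_) N+M≡F (m≤m+n N M)))
    ... | tri≈ _ refl _ = complement-leading M N+M≡F
    ... | tri> _ _ 1+i<k = complement-above k 1+i<k M N+M≡F

    complement-above (suc (suc k)) (s≤s (s≤s i≤k)) M N+M≡F with m≤n⇒m<n∨m≡n i≤k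
    ... | inj₂ refl = complement-next M N+M≡F
    ... | inj₁ 1+i≤k with N ≤? fib k
    ...   | yes N≤F = ≡suc⊓⇒≤ʳ minWeightM
                    , subst (λ z → minWeight N ≤ suc z) (sym minWeightM)
                        (≤-+⊓ 2 (≤-trans (proj₂ (complementN k c (proj₂ d))) (n≤1+n _)) (≤-suc-suc ≤-refl))
      where
      d = difference N≤F
      c = proj₁ d
      F+c≡M : fib (suc k) + c ≡ M
      F+c≡M = +-cancelˡ-≡ N (fib (suc k) + c) M
                (trans (lemma N (fib (suc k)) c) (trans (cong (fib (suc k) +_) (proj₂ d)) (sym N+M≡F)))
        where
        lemma : ∀ N x c → N + (x + c) ≡ x + (N + c)
        lemma = solve-∀
      minWeightM : minWeight M ≡ suc (minWeight c ⊓ minWeight N)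
      minWeightM = minWeight-split (suc k) M c N F+c≡M (trans (+-comm M N) N+M≡F)
    ...   | no N≰F with ≤-antisym (≤-pred (fib-cancel-< (<-≤-trans (≰⇒> N≰F) N≤fib))) 1+i≤k
    ...     | refl = complement-mirror M N+M≡F

    lipschitzN : FibLipschitz N
    add lipschitzN = addN
    sub lipschitzN = subN
    complement lipschitzN k M eq = proj₁ (complementN k M eq)
    complement′ lipschitzN k M eq = proj₂ (complementN k M eq)

  fib-bracket : ∀ N → 1 ≤ N → ∃ λ j → fib j ≤ N × N < fib (suc j)
  fib-bracket (suc zero) _ = 0 , s≤s z≤n , s≤s (s≤s z≤n)
  fib-bracket (suc (suc N)) _ with fib-bracket (suc N) (s≤s z≤n)
  ... | j , lo , hi with m≤n⇒m<n∨m≡n hi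
  ... | inj₁ lt = j , ≤-trans lo (n≤1+n _) , lt
  ... | inj₂ eq = suc j , ≤-reflexive (sym eq) , subst (_< fib (suc (suc j))) (sym eq) (fib-<-suc (suc j))

  lipschitz : ∀ N → FibLipschitz N
  lipschitz = <-rec FibLipschitz step
    where
    step : ∀ N → (∀ {m} → m < N → FibLipschitz m) → FibLipschitz N
    step zero IH = lipschitz-0
    step (suc zero) IH = lipschitz-1
    step (suc (suc N)) IH with fib-bracket (suc (suc N)) (s≤s z≤n)
    ... | zero , lo , s≤s (s≤s ())
    ... | suc i , lo , hi =
      subst FibLipschitz (proj₂ da) (InductiveStep.lipschitzN i a b a+b≡F (λ M lt → IH (subst (M <_) (proj₂ da) lt)))
      where
      da = difference lo
      a = proj₁ da
      db = difference (<⇒≤ hi)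
      b = proj₁ db
      a+b≡F : a + b ≡ fib i
      a+b≡F = +-cancelˡ-≡ (fib (suc i)) (a + b) (fib i)
                (trans (sym (+-assoc (fib (suc i)) a b)) (trans (cong (_+ b) (proj₂ da)) (proj₂ db)))

  minWeight-mono-complement-suc : ∀ j a b → suc a + b ≡ fib (suc (suc j)) → suc a ≤ b → minWeight (suc a) ≤ minWeight b
  minWeight-mono-complement-suc j a′ b a+b≡F a≤b with suc a′ ≤? fib j
  ... | yes a≤F = subst (minWeight a ≤_) (sym minWeightb) (≤-+⊓ 1 (complement′ (lipschitz a) j c (proj₂ d)) (n≤1+n _))
    where
    a = suc a′
    d = difference a≤F
    c = proj₁ d
    F+c≡b : fib (suc j) + c ≡ b
    F+c≡b = +-cancelˡ-≡ a (fib (suc j) + c) b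
              (trans (lemma a (fib (suc j)) c) (trans (cong (fib (suc j) +_) (proj₂ d)) (sym a+b≡F)))
      where
      lemma : ∀ a x c → a + (x + c) ≡ x + (a + c)
      lemma = solve-∀
    minWeightb : minWeight b ≡ suc (minWeight c ⊓ minWeight a)
    minWeightb = minWeight-split (suc j) b c a F+c≡b (trans (+-comm b a) a+b≡F)
  ... | no a≰F = ≤-reflexive (trans minWeighta (trans (cong suc (⊓-comm (minWeight a″) (minWeight e))) (sym minWeightb)))
    where
    a = suc a′
    da = difference (<⇒≤ (≰⇒> a≰F))
    a″ = proj₁ da
    a≤F : a ≤ fib (suc j)
    a≤F with a ≤? fib (suc j)
    ... | yes a≤F′ = a≤F′
    ... | no a≰F′ = ⊥-elim (<⇒≱ 2F<a+b (subst (_≤ fib (suc j) + fib (suc j)) (sym a+b≡F)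
                                            (+-monoʳ-≤ (fib (suc j)) (fib-mono-≤ (n≤1+n j)))))
      where
      F<a : fib (suc j) < a
      F<a = ≰⇒> a≰F′
      2F<a+b : fib (suc j) + fib (suc j) < a + b
      2F<a+b = <-≤-trans (+-monoʳ-< (fib (suc j)) (<-≤-trans F<a a≤b)) (+-monoˡ-≤ b (<⇒≤ F<a))
    de = difference a≤F
    e = proj₁ de
    minWeighta : minWeight a ≡ suc (minWeight a″ ⊓ minWeight e)
    minWeighta = minWeight-split j a a″ e (proj₂ da) (proj₂ de)
    F+e≡b : fib j + e ≡ b
    F+e≡b = +-cancelˡ-≡ a (fib j + e) b
              (trans (lemma a (fib j) e) (trans (cong (_+ fib j) (proj₂ de)) (sym a+b≡F)))
      where
      lemma : ∀ a x d → a + (x + d) ≡ a + d + x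
      lemma = solve-∀
    b+a″≡F : b + a″ ≡ fib (suc j)
    b+a″≡F = trans (cong (_+ a″) (sym F+e≡b))
               (trans (lemma (fib j) e a″) (trans (cong (_+ e) (proj₂ da)) (proj₂ de)))
      where
      lemma : ∀ x d y → x + d + y ≡ x + y + d
      lemma = solve-∀
    minWeightb : minWeight b ≡ suc (minWeight e ⊓ minWeight a″)
    minWeightb = minWeight-split j b e a″ F+e≡b b+a″≡F

  minWeight-mono-complement : ∀ j a b → a + b ≡ fib j → a ≤ b → minWeight a ≤ minWeight b
  minWeight-mono-complement j zero b a+b≡F a≤b = z≤n
  minWeight-mono-complement zero (suc zero) zero a+b≡F ()
  minWeight-mono-complement zero (suc zero) (suc b) ()
  minWeight-mono-complement zero (suc (suc a)) b a+b≡F a≤b =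
    ⊥-elim (<⇒≱ (s≤s (s≤s z≤n)) (subst (2 ≤_) a+b≡F (≤-trans (s≤s (s≤s z≤n)) (m≤m+n (suc (suc a)) b))))
  minWeight-mono-complement (suc zero) (suc zero) zero a+b≡F ()
  minWeight-mono-complement (suc zero) (suc zero) (suc zero) a+b≡F a≤b = ≤-refl
  minWeight-mono-complement (suc zero) (suc zero) (suc (suc b)) () a≤b
  minWeight-mono-complement (suc zero) (suc (suc a)) b a+b≡F a≤b =
    ⊥-elim (<⇒≱ (s≤s (s≤s (s≤s z≤n)))
                (subst (4 ≤_) a+b≡F (+-mono-≤ {2} {suc (suc a)} {2} {b} (s≤s (s≤s z≤n)) (≤-trans (s≤s (s≤s z≤n)) a≤b))))
  minWeight-mono-complement (suc (suc j)) (suc a) b a+b≡F a≤b = minWeight-mono-complement-suc j a b a+b≡F a≤b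


module IntegerWeight where
  open import Data.Nat as ℕ using (ℕ; zero; suc; z≤n; s≤s)
  import Data.Nat.Properties as ℕP
  open import Data.Integer as ℤ using (ℤ; +_; -[1+_]; _+_; _*_; -_; _-_; ∣_∣)
  import Data.Integer.Properties as ℤP
  open import Data.Integer.Tactic.RingSolver
  open import Data.List using ([]; _∷_; length)
  open import Relation.Nullary using (yes; no)
  open import Relation.Binary.PropositionalEquality
  open import Defs
  open Fibonacci
  open MinimalWeight
  open Lipschitz

  F≡fib : ∀ n → F n ≡ + fib n
  F≡fib zero = refl
  F≡fib (suc zero) = refl
  F≡fib (suc (suc n)) rewrite F≡fib (suc n) | F≡fib n = refl

  minWeightℤ : ℤ → ℕ
  minWeightℤ z = minWeight ∣ z ∣

  minWeightℤ-neg : ∀ z → minWeightℤ (- z) ≡ minWeightℤ z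
  minWeightℤ-neg z = cong minWeight (ℤP.∣-i∣≡∣i∣ z)

  minWeightℤ-add-fib : ∀ z k → minWeightℤ (z + + fib k) ℕ.≤ suc (minWeightℤ z)
  minWeightℤ-add-fib (+ N) k = add (lipschitz N) k
  minWeightℤ-add-fib -[1+ n ] k with suc n ℕ.≤? fib k
  ... | yes n<F = subst (λ u → minWeight ∣ u ∣ ℕ.≤ suc (minWeight (suc n))) (sym (ℤP.⊖-≥ n<F))
                    (complement (lipschitz (suc n)) k _ (ℕP.m+[n∸m]≡n n<F))
  ... | no n≮F = subst (λ u → minWeight u ℕ.≤ suc (minWeight (suc n))) (sym (ℤP.∣⊖∣-≰ n≮F))
                   (sub (lipschitz (suc n)) k _ (ℕP.m∸n+n≡m (ℕP.<⇒≤ (ℕP.≰⇒> n≮F))))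

  minWeightℤ-sub-fib : ∀ z k → minWeightℤ (z - + fib k) ℕ.≤ suc (minWeightℤ z)
  minWeightℤ-sub-fib z k = begin
    minWeightℤ (z - + fib k)           ≡⟨ cong minWeightℤ (lemma z (+ fib k)) ⟩
    minWeightℤ (- ((- z) + + fib k))   ≡⟨ minWeightℤ-neg ((- z) + + fib k) ⟩
    minWeightℤ ((- z) + + fib k)       ≤⟨ minWeightℤ-add-fib (- z) k ⟩
    suc (minWeightℤ (- z))             ≡⟨ cong suc (minWeightℤ-neg z) ⟩
    suc (minWeightℤ z)                 ∎
    where
    open ℕP.≤-Reasoning
    lemma : ∀ z x → z - x ≡ - ((- z) + x)
    lemma = solve-∀

  minWeightℤ-add-multiple⁺ : ∀ m k z → minWeightℤ (+ m * + fib k + z) ℕ.≤ m ℕ.+ minWeightℤ z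
  minWeightℤ-add-multiple⁺ zero k z = ℕP.≤-reflexive (cong minWeightℤ (lemma (+ fib k) z))
    where
    lemma : ∀ x z → + 0 * x + z ≡ z
    lemma = solve-∀
  minWeightℤ-add-multiple⁺ (suc m) k z =
    subst (λ u → minWeightℤ u ℕ.≤ suc m ℕ.+ minWeightℤ z) (sym (lemma (+ m) (+ fib k) z))
      (ℕP.≤-trans (minWeightℤ-add-fib (+ m * + fib k + z) k) (s≤s (minWeightℤ-add-multiple⁺ m k z)))
    where
    lemma : ∀ t x z → (+ 1 + t) * x + z ≡ (t * x + z) + x
    lemma = solve-∀

  minWeightℤ-add-multiple⁻ : ∀ m k z → minWeightℤ ((- + m) * + fib k + z) ℕ.≤ m ℕ.+ minWeightℤ z
  minWeightℤ-add-multiple⁻ zero k z = ℕP.≤-reflexive (cong minWeightℤ (lemma (+ fib k) z))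
    where
    lemma : ∀ x z → (- + 0) * x + z ≡ z
    lemma = solve-∀
  minWeightℤ-add-multiple⁻ (suc m) k z =
    subst (λ u → minWeightℤ u ℕ.≤ suc m ℕ.+ minWeightℤ z) (sym (lemma (+ m) (+ fib k) z))
      (ℕP.≤-trans (minWeightℤ-sub-fib ((- + m) * + fib k + z) k) (s≤s (minWeightℤ-add-multiple⁻ m k z)))
    where
    lemma : ∀ t x z → (- (+ 1 + t)) * x + z ≡ ((- t) * x + z) - x
    lemma = solve-∀

  minWeightℤ-add-multiple : ∀ a k z → minWeightℤ (a * + fib k + z) ℕ.≤ ∣ a ∣ ℕ.+ minWeightℤ z
  minWeightℤ-add-multiple (+ m) k z = minWeightℤ-add-multiple⁺ m k z
  minWeightℤ-add-multiple -[1+ m ] k z = minWeightℤ-add-multiple⁻ (suc m) k z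

  minWeight-fval≤weight : ∀ y → minWeightℤ (fval y) ℕ.≤ weight y
  minWeight-fval≤weight [] = z≤n
  minWeight-fval≤weight (a ∷ y) rewrite F≡fib (length y) =
    ℕP.≤-trans (minWeightℤ-add-multiple a (length y) (fval y)) (ℕP.+-monoʳ-≤ ∣ a ∣ (minWeight-fval≤weight y))


module Rewriting where
  open import Data.Nat as ℕ using (ℕ; zero; suc)
  import Data.Nat.Properties as ℕP
  open import Data.Integer as ℤ using (ℤ; +_; -[1+_]; _+_; _*_; -_; _-_; ∣_∣)
  import Data.Integer.Properties as ℤP
  open import Data.Integer.Tactic.RingSolver
  open import Data.List using ([]; _∷_; length; _++_; map)
  open import Data.List.Properties using (length-++; length-map; ++-assoc)
  open import Data.Product using (_,_; proj₁; proj₂)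
  open import Data.Empty using (⊥-elim)
  open import Relation.Binary.PropositionalEquality
  open import Defs

  pattern P1 = +_ (suc zero)
  pattern N1 = -[1+_] zero
  pattern Z0 = +_ zero

  [0] : Word
  [0] = Z0 ∷ []

  negate : Word → Word
  negate = map (-_)

  negate-involutive : ∀ w → negate (negate w) ≡ w
  negate-involutive [] = refl
  negate-involutive (a ∷ w) = cong₂ _∷_ (ℤP.neg-involutive a) (negate-involutive w)

  weight-negate : ∀ w → weight (negate w) ≡ weight w
  weight-negate [] = refl
  weight-negate (a ∷ w) = cong₂ ℕ._+_ (ℤP.∣-i∣≡∣i∣ a) (weight-negate w)

  fval-negate : ∀ w → fval (negate w) ≡ - fval w
  fval-negate [] = refl
  fval-negate (a ∷ w) rewrite length-map (-_) w | fval-negate w = lemma a (F (length w)) (fval w)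
    where
    lemma : ∀ a x r → (- a) * x + (- r) ≡ - (a * x + r)
    lemma = solve-∀

  weight-++ : ∀ p v → weight (p ++ v) ≡ weight p ℕ.+ weight v
  weight-++ [] v = refl
  weight-++ (a ∷ p) v rewrite weight-++ p v = sym (ℕP.+-assoc ∣ a ∣ (weight p) (weight v))

  fval-++-cong : ∀ p {v v′} → length v ≡ length v′ → fval v ≡ fval v′ → fval (p ++ v) ≡ fval (p ++ v′)
  fval-++-cong [] _ fval≡ = fval≡
  fval-++-cong (a ∷ p) {v} {v′} length≡ fval≡
    rewrite length-++ p {v} | length-++ p {v′} | length≡ | fval-++-cong p {v} {v′} length≡ fval≡ = refl

  βval-++-cong : ∀ p {v v′} → length v ≡ length v′ → βval v ≡ βval v′ → βval (p ++ v) ≡ βval (p ++ v′)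
  βval-++-cong [] _ βval≡ = βval≡
  βval-++-cong (a ∷ p) {v} {v′} length≡ βval≡
    rewrite length-++ p {v} | length-++ p {v′} | length≡ | βval-++-cong p {v} {v′} length≡ βval≡ = refl

  βpow : ℕ → Zβ
  βpow n = mulβ^ n (ι (+ 1))

  mulβ^-ι : ∀ n a → mulβ^ n (ι a) ≡ (a * proj₁ (βpow n) , a * proj₂ (βpow n))
  mulβ^-ι zero a = cong₂ _,_ (sym (ℤP.*-identityʳ a)) (sym (ℤP.*-zeroʳ a))
  mulβ^-ι (suc n) a rewrite mulβ^-ι n a = cong₂ _,_ refl (sym (ℤP.*-distribˡ-+ a (proj₁ (βpow n)) (proj₂ (βpow n))))

  -- The additive map a + bβ ↦ a + 2b sends β^n to F_n, hence βval to fval.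
  toF : Zβ → ℤ
  toF (a , b) = a + (b + b)

  F≡toF-βpow : ∀ n → F n ≡ toF (βpow n)
  F≡toF-βpow zero = refl
  F≡toF-βpow (suc zero) = refl
  F≡toF-βpow (suc (suc n)) rewrite F≡toF-βpow (suc n) | F≡toF-βpow n = lemma (proj₁ (βpow n)) (proj₂ (βpow n))
    where
    lemma : ∀ p q → (q + ((p + q) + (p + q))) + (p + (q + q)) ≡ (p + q) + ((q + (p + q)) + (q + (p + q)))
    lemma = solve-∀

  fval≡toF-βval : ∀ z → fval z ≡ toF (βval z)
  fval≡toF-βval [] = refl
  fval≡toF-βval (a ∷ z) rewrite mulβ^-ι (length z) a | F≡toF-βpow (length z) | fval≡toF-βval z =
    lemma a (proj₁ (βpow (length z))) (proj₂ (βpow (length z))) (proj₁ (βval z)) (proj₂ (βval z))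
    where
    lemma : ∀ a p q u v → a * (p + (q + q)) + (u + (v + v)) ≡ (a * p + u) + ((a * q + v) + (a * q + v))
    lemma = solve-∀

  toF-mulβ-injective : ∀ x y → toF x ≡ toF y → toF (mulβ x) ≡ toF (mulβ y) → x ≡ y
  toF-mulβ-injective (a , b) (a′ , b′) toF≡ toFβ≡ = cong₂ _,_ a≡a′ b≡b′
    where
    b-from : ∀ a b → b ≡ (a + (b + b)) + (a + (b + b)) - (b + ((a + b) + (a + b)))
    b-from = solve-∀
    a-from : ∀ a b → a ≡ (a + (b + b)) - (b + b)
    a-from = solve-∀
    b≡b′ : b ≡ b′
    b≡b′ = trans (b-from a b) (trans (cong₂ (λ x y → x + x - y) toF≡ toFβ≡) (sym (b-from a′ b′)))
    a≡a′ : a ≡ a′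
    a≡a′ = trans (a-from a b) (trans (cong₂ (λ x y → x - (y + y)) toF≡ b≡b′) (sym (a-from a′ b′)))

  mulβ-distrib-⊕ : ∀ u v → mulβ (u ⊕ v) ≡ mulβ u ⊕ mulβ v
  mulβ-distrib-⊕ (a , b) (c , d) = cong₂ _,_ refl (lemma a b c d)
    where
    lemma : ∀ a b c d → (a + c) + (b + d) ≡ (a + b) + (c + d)
    lemma = solve-∀

  length-++-[0] : ∀ z → length (z ++ [0]) ≡ suc (length z)
  length-++-[0] [] = refl
  length-++-[0] (a ∷ z) = cong suc (length-++-[0] z)

  βval-++-[0] : ∀ z → βval (z ++ [0]) ≡ mulβ (βval z)
  βval-++-[0] [] = refl
  βval-++-[0] (a ∷ z) rewrite length-++-[0] z | βval-++-[0] z = sym (mulβ-distrib-⊕ (mulβ^ (length z) (ι a)) (βval z))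

  fval-++-[0] : ∀ z → fval (z ++ [0]) ≡ toF (mulβ (βval z))
  fval-++-[0] z = trans (fval≡toF-βval (z ++ [0])) (cong toF (βval-++-[0] z))

  βval≡-from-fval≡ : ∀ u v → fval u ≡ fval v → fval (u ++ [0]) ≡ fval (v ++ [0]) → βval u ≡ βval v
  βval≡-from-fval≡ u v fval≡ fval0≡ = toF-mulβ-injective (βval u) (βval v)
    (trans (sym (fval≡toF-βval u)) (trans fval≡ (fval≡toF-βval v)))
    (trans (sym (fval-++-[0] u)) (trans fval0≡ (fval-++-[0] v)))

  negateβ : Zβ → Zβ
  negateβ (a , b) = (- a , - b)

  βval-negate : ∀ w → βval (negate w) ≡ negateβ (βval w)
  βval-negate [] = refl
  βval-negate (a ∷ w) rewrite length-map (-_) w | βval-negate w | mulβ^-ι (length w) (- a) | mulβ^-ι (length w) a =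
    cong₂ _,_ (lemma a (proj₁ (βpow (length w))) (proj₁ (βval w))) (lemma a (proj₂ (βpow (length w))) (proj₂ (βval w)))
    where
    lemma : ∀ a p u → (- a) * p + (- u) ≡ - (a * p + u)
    lemma = solve-∀

  record SameValue (v u : Word) : Set where
    field
      same-length : length v ≡ length u
      same-fval   : fval v ≡ fval u
      same-βval   : βval v ≡ βval u
  open SameValue public

  -- A rule preserving F-values in every right context also preserves β-values,
  -- since the F-values of u and u·0 determine βval u.
  rewriteRule : ∀ p q → length q ≡ length p → (∀ w → fval (q ++ w) ≡ fval (p ++ w)) → ∀ w → SameValue (q ++ w) (p ++ w)
  rewriteRule p q length≡ fval≡ w = record
    { same-length = trans (length-++ q) (trans (cong (ℕ._+ length w) length≡) (sym (length-++ p)))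
    ; same-fval = fval≡ w
    ; same-βval = βval≡-from-fval≡ (q ++ w) (p ++ w) (fval≡ w)
        (subst₂ (λ x y → fval x ≡ fval y) (sym (++-assoc q w [0])) (sym (++-assoc p w [0])) (fval≡ (w ++ [0])))
    }

  data EndsWith0 : Word → Set where
    last : EndsWith0 [0]
    _∷_  : ∀ a {w} → EndsWith0 w → EndsWith0 (a ∷ w)

  endsWith0-++-[0] : ∀ z → EndsWith0 (z ++ [0])
  endsWith0-++-[0] [] = last
  endsWith0-++-[0] (a ∷ z) = a ∷ endsWith0-++-[0] z

  endsWith0-negate⁻ : ∀ w → EndsWith0 (negate w) → EndsWith0 w
  endsWith0-negate⁻ (Z0 ∷ []) last = last
  endsWith0-negate⁻ (a ∷ w) (_ ∷ e) = a ∷ endsWith0-negate⁻ w e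

  endsWith0-suffix : ∀ p {a w} → EndsWith0 (p ++ a ∷ w) → EndsWith0 (a ∷ w)
  endsWith0-suffix [] e = e
  endsWith0-suffix (_ ∷ []) (_ ∷ e) = e
  endsWith0-suffix (_ ∷ b ∷ p) (_ ∷ e) = endsWith0-suffix (b ∷ p) e

  endsWith0-tail : ∀ {a w} → w ≢ [] → EndsWith0 (a ∷ w) → EndsWith0 w
  endsWith0-tail w≢[] last = ⊥-elim (w≢[] refl)
  endsWith0-tail _ (_ ∷ e) = e

  -- A lighter word of the same length and F-value as U. The β-value is only promised when the
  -- tail w ends in 0: at the right end, 1·F₁ − F₀ = F₀ holds although β − 1 ≠ 1.
  record Improvement (U w : Word) : Set where
    constructor improvement
    field
      lighter        : Word
      lighter-length : length lighter ≡ length U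
      lighter-fval   : fval lighter ≡ fval U
      lighter-weight : weight lighter ℕ.< weight U
      lighter-βval   : EndsWith0 w → βval lighter ≡ βval U

  Improvement-prefix : ∀ p {U w} → Improvement U w → Improvement (p ++ U) w
  Improvement-prefix p {U} (improvement v length≡ fval≡ weight< βval≡) =
    improvement (p ++ v) (trans (length-++ p) (trans (cong (length p ℕ.+_) length≡) (sym (length-++ p))))
      (fval-++-cong p length≡ fval≡)
      (subst₂ ℕ._<_ (sym (weight-++ p v)) (sym (weight-++ p U)) (ℕP.+-monoʳ-< (weight p) weight<))
      (λ e → βval-++-cong p length≡ (βval≡ e))

  Improvement-negate : ∀ {U w} → Improvement U w → Improvement (negate U) (negate w)
  Improvement-negate {U} {w} (improvement v length≡ fval≡ weight< βval≡) =
    improvement (negate v) (trans (length-map (-_) v) (trans length≡ (sym (length-map (-_) U))))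
      (trans (fval-negate v) (trans (cong -_ fval≡) (sym (fval-negate U))))
      (subst₂ ℕ._<_ (sym (weight-negate v)) (sym (weight-negate U)) weight<)
      (λ e → trans (βval-negate v) (trans (cong negateβ (βval≡ (endsWith0-negate⁻ w e))) (sym (βval-negate U))))

  Improvement-negate⁻ : ∀ {U w} → Improvement (negate U) (negate w) → Improvement U w
  Improvement-negate⁻ {U} {w} i = subst₂ Improvement (negate-involutive U) (negate-involutive w) (Improvement-negate i)

  Improvement-retail : ∀ {U w w′} → Improvement U w′ → (EndsWith0 w → EndsWith0 w′) → Improvement U w
  Improvement-retail (improvement v length≡ fval≡ weight< βval≡) e⇒e′ =
    improvement v length≡ fval≡ weight< (λ e → βval≡ (e⇒e′ e))

  Improvement-via : ∀ {U M w w′} → SameValue M U → weight M ℕ.≤ weight U → Improvement M w′ →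
    (EndsWith0 w → EndsWith0 w′) → Improvement U w
  Improvement-via M≈U weight≤ (improvement v length≡ fval≡ weight< βval≡) e⇒e′ =
    improvement v (trans length≡ (same-length M≈U)) (trans fval≡ (same-fval M≈U)) (ℕP.<-≤-trans weight< weight≤)
      (λ e → trans (βval≡ (e⇒e′ e)) (same-βval M≈U))

  improvement-by : ∀ {U M} w → SameValue M U → weight M ℕ.< weight U → Improvement U w
  improvement-by w M≈U weight< = improvement _ (same-length M≈U) (same-fval M≈U) weight< (λ _ → same-βval M≈U)

  fval-Z0∷ : ∀ x → fval (Z0 ∷ x) ≡ fval x
  fval-Z0∷ x = ℤP.+-identityˡ (fval x)

  βval-Z0∷ : ∀ x → βval (Z0 ∷ x) ≡ βval x
  βval-Z0∷ x rewrite mulβ^-ι (length x) Z0 =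
    cong₂ _,_ (ℤP.+-identityˡ (proj₁ (βval x))) (ℤP.+-identityˡ (proj₂ (βval x)))

  fval≡-from-βval≡ : ∀ u v → βval u ≡ βval v → fval u ≡ fval v
  fval≡-from-βval≡ u v βval≡ = trans (fval≡toF-βval u) (trans (cong toF βval≡) (sym (fval≡toF-βval v)))


module ForbiddenFactors where
  open import Data.Nat as ℕ using (ℕ; suc; s≤s)
  import Data.Nat.Properties as ℕP
  open import Data.Integer as ℤ using (ℤ; +_; -[1+_]; _+_; _*_; -_; ∣_∣)
  import Data.Integer.Properties as ℤP
  open import Data.Integer.Tactic.RingSolver
  open import Data.List using ([]; _∷_; length; _++_)
  open import Data.List.Properties using (map-++)
  open import Data.Product using (_×_; _,_; ∃)
  open import Data.Empty using (⊥-elim)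
  open import Data.Sum using (_⊎_; inj₁; inj₂)
  open import Relation.Binary.PropositionalEquality
  open import Defs
  open Rewriting

  data Tail (d : ℤ) : Word → Set where
    0·0·0·d∷_ : ∀ {w} → Tail d w → Tail d (Z0 ∷ Z0 ∷ Z0 ∷ d ∷ w)
    0·d       : ∀ {w} → Tail d (Z0 ∷ d ∷ w)
    0·0·d     : ∀ {w} → Tail d (Z0 ∷ Z0 ∷ d ∷ w)

  data Forbidden⁺ : Word → Set where
    1·1     : ∀ {w} → Forbidden⁺ (P1 ∷ P1 ∷ w)
    1·1̄     : ∀ {w} → Forbidden⁺ (P1 ∷ N1 ∷ w)
    1·0·1̄   : ∀ {w} → Forbidden⁺ (P1 ∷ Z0 ∷ N1 ∷ w)
    1·0·0·1̄ : ∀ {w} → Tail N1 w → Forbidden⁺ (P1 ∷ Z0 ∷ Z0 ∷ N1 ∷ w)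
    1·0·1   : ∀ {w} → Tail P1 w → Forbidden⁺ (P1 ∷ Z0 ∷ P1 ∷ w)

  data Forbidden⁻ : Word → Set where
    1̄·1̄     : ∀ {w} → Forbidden⁻ (N1 ∷ N1 ∷ w)
    1̄·1     : ∀ {w} → Forbidden⁻ (N1 ∷ P1 ∷ w)
    1̄·0·1   : ∀ {w} → Forbidden⁻ (N1 ∷ Z0 ∷ P1 ∷ w)
    1̄·0·0·1 : ∀ {w} → Tail P1 w → Forbidden⁻ (N1 ∷ Z0 ∷ Z0 ∷ P1 ∷ w)
    1̄·0·1̄   : ∀ {w} → Tail N1 w → Forbidden⁻ (N1 ∷ Z0 ∷ N1 ∷ w)

  Forbidden : Word → Set
  Forbidden w = Forbidden⁺ w ⊎ Forbidden⁻ w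

  data HasForbidden : Word → Set where
    here  : ∀ {w} → Forbidden w → HasForbidden w
    there : ∀ {a w} → HasForbidden w → HasForbidden (a ∷ w)

  Tail-negate : ∀ {d w} → Tail d w → Tail (- d) (negate w)
  Tail-negate (0·0·0·d∷ t) = 0·0·0·d∷ Tail-negate t
  Tail-negate 0·d = 0·d
  Tail-negate 0·0·d = 0·0·d

  Forbidden⁻-negate : ∀ {w} → Forbidden⁻ w → Forbidden⁺ (negate w)
  Forbidden⁻-negate 1̄·1̄ = 1·1
  Forbidden⁻-negate 1̄·1 = 1·1̄
  Forbidden⁻-negate 1̄·0·1 = 1·0·1̄
  Forbidden⁻-negate (1̄·0·0·1 t) = 1·0·0·1̄ (Tail-negate t)
  Forbidden⁻-negate (1̄·0·1̄ t) = 1·0·1 (Tail-negate t)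

  Forbidden⁺-negate : ∀ {w} → Forbidden⁺ w → Forbidden⁻ (negate w)
  Forbidden⁺-negate 1·1 = 1̄·1̄
  Forbidden⁺-negate 1·1̄ = 1̄·1
  Forbidden⁺-negate 1·0·1̄ = 1̄·0·1
  Forbidden⁺-negate (1·0·0·1̄ t) = 1̄·0·0·1 (Tail-negate t)
  Forbidden⁺-negate (1·0·1 t) = 1̄·0·1̄ (Tail-negate t)

  HasForbidden-negate : ∀ {w} → HasForbidden w → HasForbidden (negate w)
  HasForbidden-negate (here (inj₁ f)) = here (inj₂ (Forbidden⁺-negate f))
  HasForbidden-negate (here (inj₂ f)) = here (inj₁ (Forbidden⁻-negate f))
  HasForbidden-negate (there f) = there (HasForbidden-negate f)

  carry-1·1 : ∀ a w → SameValue ((a + P1) ∷ Z0 ∷ Z0 ∷ w) (a ∷ P1 ∷ P1 ∷ w)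
  carry-1·1 a = rewriteRule (a ∷ P1 ∷ P1 ∷ []) ((a + P1) ∷ Z0 ∷ Z0 ∷ []) refl
    (λ w → lemma a (F (suc (length w))) (F (length w)) (fval w))
    where
    lemma : ∀ a x y r → (a + + 1) * (x + y) + (+ 0 * x + (+ 0 * y + r)) ≡ a * (x + y) + (+ 1 * x + (+ 1 * y + r))
    lemma = solve-∀

  shift-1·1̄ : ∀ d w → SameValue (Z0 ∷ Z0 ∷ (d + P1) ∷ w) (P1 ∷ N1 ∷ d ∷ w)
  shift-1·1̄ d = rewriteRule (P1 ∷ N1 ∷ d ∷ []) (Z0 ∷ Z0 ∷ (d + P1) ∷ []) refl
    (λ w → lemma d (F (suc (length w))) (F (length w)) (fval w))
    where
    lemma : ∀ d x y r → + 0 * (x + y) + (+ 0 * x + ((d + + 1) * y + r)) ≡ + 1 * (x + y) + (-[1+ 0 ] * x + (d * y + r))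
    lemma = solve-∀

  shift-1·0·1̄ : ∀ w → SameValue (Z0 ∷ P1 ∷ Z0 ∷ w) (P1 ∷ Z0 ∷ N1 ∷ w)
  shift-1·0·1̄ = rewriteRule (P1 ∷ Z0 ∷ N1 ∷ []) (Z0 ∷ P1 ∷ Z0 ∷ []) refl
    (λ w → lemma (F (suc (length w))) (F (length w)) (fval w))
    where
    lemma : ∀ x y r → + 0 * (x + y) + (+ 1 * x + (+ 0 * y + r)) ≡ + 1 * (x + y) + (+ 0 * x + (-[1+ 0 ] * y + r))
    lemma = solve-∀

  shift-1·0·0·1̄·0 : ∀ w → SameValue (Z0 ∷ P1 ∷ Z0 ∷ Z0 ∷ P1 ∷ w) (P1 ∷ Z0 ∷ Z0 ∷ N1 ∷ Z0 ∷ w)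
  shift-1·0·0·1̄·0 = rewriteRule (P1 ∷ Z0 ∷ Z0 ∷ N1 ∷ Z0 ∷ []) (Z0 ∷ P1 ∷ Z0 ∷ Z0 ∷ P1 ∷ []) refl
    (λ w → lemma (F (suc (length w))) (F (length w)) (fval w))
    where
    lemma : ∀ x y r →
      + 0 * ((((x + y) + x) + (x + y))) + (+ 1 * ((x + y) + x) + (+ 0 * (x + y) + (+ 0 * x + (+ 1 * y + r))))
        ≡ + 1 * ((((x + y) + x) + (x + y))) + (+ 0 * ((x + y) + x) + (+ 0 * (x + y) + (-[1+ 0 ] * x + (+ 0 * y + r))))
    lemma = solve-∀

  carry-1·0·1·0 : ∀ a w → SameValue ((a + P1) ∷ Z0 ∷ Z0 ∷ Z0 ∷ N1 ∷ w) (a ∷ P1 ∷ Z0 ∷ P1 ∷ Z0 ∷ w)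
  carry-1·0·1·0 a = rewriteRule (a ∷ P1 ∷ Z0 ∷ P1 ∷ Z0 ∷ []) ((a + P1) ∷ Z0 ∷ Z0 ∷ Z0 ∷ N1 ∷ []) refl
    (λ w → lemma a (F (suc (length w))) (F (length w)) (fval w))
    where
    lemma : ∀ a x y r →
      (a + + 1) * ((((x + y) + x) + (x + y))) + (+ 0 * ((x + y) + x) + (+ 0 * (x + y) + (+ 0 * x + (-[1+ 0 ] * y + r))))
        ≡ a * ((((x + y) + x) + (x + y))) + (+ 1 * ((x + y) + x) + (+ 0 * (x + y) + (+ 1 * x + (+ 0 * y + r))))
    lemma = solve-∀

  ∣+1∣≤suc∣∣ : ∀ a → ∣ a + P1 ∣ ℕ.≤ suc ∣ a ∣
  ∣+1∣≤suc∣∣ a = ℕP.≤-trans (ℤP.∣i+j∣≤∣i∣+∣j∣ a P1) (ℕP.≤-reflexive (ℕP.+-comm ∣ a ∣ 1))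

  improve-1·1̄ : ∀ w → Improvement (P1 ∷ N1 ∷ w) w
  improve-1·1̄ [] = improvement (Z0 ∷ P1 ∷ []) refl refl ℕP.≤-refl (λ ())
  improve-1·1̄ (d ∷ w) = improvement-by (d ∷ w) (shift-1·1̄ d w) (s≤s (ℕP.+-monoˡ-≤ (weight w) (∣+1∣≤suc∣∣ d)))

  improve-1·0·1̄ : ∀ w → Improvement (P1 ∷ Z0 ∷ N1 ∷ w) w
  improve-1·0·1̄ w = improvement-by w (shift-1·0·1̄ w) ℕP.≤-refl

  -- Each 1 0 0 1̄ 0 is traded for the equally heavy 0 1 0 0 1, pushing the 1̄ along the tail
  -- until it meets its partner and a shorter rule applies.
  improve-1·0·0·1̄ : ∀ w → Tail N1 w → Improvement (P1 ∷ Z0 ∷ Z0 ∷ N1 ∷ w) w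
  improve-1·0·0·1̄ _ (0·0·0·d∷_ {w} t) =
    Improvement-via (shift-1·0·0·1̄·0 (Z0 ∷ Z0 ∷ N1 ∷ w)) ℕP.≤-refl
      (Improvement-prefix (Z0 ∷ P1 ∷ Z0 ∷ Z0 ∷ []) (improve-1·0·0·1̄ w t)) λ { (_ ∷ _ ∷ _ ∷ _ ∷ e) → e }
  improve-1·0·0·1̄ _ (0·d {w}) =
    Improvement-via (shift-1·0·0·1̄·0 (N1 ∷ w)) ℕP.≤-refl
      (Improvement-prefix (Z0 ∷ P1 ∷ Z0 ∷ Z0 ∷ []) (improve-1·1̄ w)) λ { (_ ∷ _ ∷ e) → e }
  improve-1·0·0·1̄ _ (0·0·d {w}) =
    Improvement-via (shift-1·0·0·1̄·0 (Z0 ∷ N1 ∷ w)) ℕP.≤-refl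
      (Improvement-prefix (Z0 ∷ P1 ∷ Z0 ∷ Z0 ∷ []) (improve-1·0·1̄ w)) λ { (_ ∷ _ ∷ _ ∷ e) → e }

  improve-1̄ : ∀ v → Tail P1 (Z0 ∷ v) → Improvement (N1 ∷ v) v
  improve-1̄ _ (0·0·0·d∷_ {w} t) =
    Improvement-negate⁻ (Improvement-retail (improve-1·0·0·1̄ (negate w) (Tail-negate t)) λ { (_ ∷ _ ∷ _ ∷ e) → e })
  improve-1̄ _ (0·d {w}) = Improvement-negate⁻ (Improvement-retail (improve-1·1̄ (negate w)) λ { (_ ∷ e) → e })
  improve-1̄ _ (0·0·d {w}) = Improvement-negate⁻ (Improvement-retail (improve-1·0·1̄ (negate w)) λ { (_ ∷ _ ∷ e) → e })

  improve-1·0·1 : ∀ a w → Tail P1 w → Improvement (a ∷ P1 ∷ Z0 ∷ P1 ∷ w) w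
  improve-1·0·1 a (Z0 ∷ v) t =
    Improvement-via (carry-1·0·1·0 a v) weight≤ (Improvement-prefix ((a + P1) ∷ Z0 ∷ Z0 ∷ Z0 ∷ []) (improve-1̄ v t))
      λ { (_ ∷ e) → e }
    where
    weight≤ : ∣ a + P1 ∣ ℕ.+ suc (weight v) ℕ.≤ ∣ a ∣ ℕ.+ suc (suc (weight v))
    weight≤ = ℕP.≤-trans (ℕP.+-monoˡ-≤ (suc (weight v)) (∣+1∣≤suc∣∣ a)) (ℕP.≤-reflexive (sym (ℕP.+-suc ∣ a ∣ (suc (weight v)))))

  improve-forbidden⁺ : ∀ a w → Forbidden⁺ w → Improvement (a ∷ w) w
  improve-forbidden⁺ a _ (1·1 {w}) = improvement-by _ (carry-1·1 a w) weight<
    where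
    weight< : ∣ a + P1 ∣ ℕ.+ weight w ℕ.< ∣ a ∣ ℕ.+ suc (suc (weight w))
    weight< = ℕP.≤-trans (s≤s (ℕP.+-monoˡ-≤ (weight w) (∣+1∣≤suc∣∣ a)))
                (ℕP.≤-reflexive (sym (trans (ℕP.+-suc ∣ a ∣ (suc (weight w))) (cong suc (ℕP.+-suc ∣ a ∣ (weight w))))))
  improve-forbidden⁺ a _ (1·1̄ {w}) =
    Improvement-retail (Improvement-prefix (a ∷ []) (improve-1·1̄ w)) λ { (_ ∷ _ ∷ e) → e }
  improve-forbidden⁺ a _ (1·0·1̄ {w}) =
    Improvement-retail (Improvement-prefix (a ∷ []) (improve-1·0·1̄ w)) λ { (_ ∷ _ ∷ _ ∷ e) → e }
  improve-forbidden⁺ a _ (1·0·0·1̄ {w} t) =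
    Improvement-retail (Improvement-prefix (a ∷ []) (improve-1·0·0·1̄ w t)) λ { (_ ∷ _ ∷ _ ∷ _ ∷ e) → e }
  improve-forbidden⁺ a _ (1·0·1 {w} t) = Improvement-retail (improve-1·0·1 a w t) λ { (_ ∷ _ ∷ _ ∷ e) → e }

  improve-forbidden : ∀ a w → Forbidden w → Improvement (a ∷ w) w
  improve-forbidden a w (inj₁ f) = improve-forbidden⁺ a w f
  improve-forbidden a w (inj₂ f) =
    subst₂ Improvement (cong₂ _∷_ (ℤP.neg-involutive a) (negate-involutive w)) (negate-involutive w)
      (Improvement-negate (improve-forbidden⁺ (- a) (negate w) (Forbidden⁻-negate f)))

  -- A digit is needed in front of the factor to absorb a carry; a leading 0 provides it.
  split-at-forbidden : ∀ x → HasForbidden x → ∀ c → ∃ λ pre → ∃ λ a → ∃ λ w → (c ∷ x ≡ pre ++ a ∷ w) × Forbidden w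
  split-at-forbidden x (here f) c = [] , c , x , refl , f
  split-at-forbidden (a′ ∷ w′) (there f) c with split-at-forbidden w′ f a′
  ... | pre , a , w , eq , f′ = c ∷ pre , a , w , cong (c ∷_) eq , f′

  weight-split< : ∀ pre {y v a w} → y ≡ pre ++ a ∷ w → weight v ℕ.< weight (a ∷ w) → weight (pre ++ v) ℕ.< weight y
  weight-split< pre {v = v} {a} {w} refl weight< =
    subst₂ ℕ._<_ (sym (weight-++ pre v)) (sym (weight-++ pre (a ∷ w))) (ℕP.+-monoʳ-< (weight pre) weight<)

  hasForbidden⇒F-heavy : ∀ x → HasForbidden x → F-heavy x
  hasForbidden⇒F-heavy x f with split-at-forbidden x f Z0
  ... | pre , a , w , eq , f′ with improve-forbidden a w f′
  ... | improvement v length≡ fval≡ weight< _ = pre ++ v , fval≡′ , weight-split< pre eq weight<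
    where
    fval≡′ : fval x ≡ fval (pre ++ v)
    fval≡′ = sym (trans (fval-++-cong pre length≡ fval≡) (trans (cong fval (sym eq)) (fval-Z0∷ x)))

  Tail-++ : ∀ {d w} z → Tail d w → Tail d (w ++ z)
  Tail-++ z (0·0·0·d∷ t) = 0·0·0·d∷ Tail-++ z t
  Tail-++ z 0·d = 0·d
  Tail-++ z 0·0·d = 0·0·d

  Forbidden-++ : ∀ {w} z → Forbidden w → Forbidden (w ++ z)
  Forbidden-++ z (inj₁ 1·1) = inj₁ 1·1
  Forbidden-++ z (inj₁ 1·1̄) = inj₁ 1·1̄
  Forbidden-++ z (inj₁ 1·0·1̄) = inj₁ 1·0·1̄
  Forbidden-++ z (inj₁ (1·0·0·1̄ t)) = inj₁ (1·0·0·1̄ (Tail-++ z t))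
  Forbidden-++ z (inj₁ (1·0·1 t)) = inj₁ (1·0·1 (Tail-++ z t))
  Forbidden-++ z (inj₂ 1̄·1̄) = inj₂ 1̄·1̄
  Forbidden-++ z (inj₂ 1̄·1) = inj₂ 1̄·1
  Forbidden-++ z (inj₂ 1̄·0·1) = inj₂ 1̄·0·1
  Forbidden-++ z (inj₂ (1̄·0·0·1 t)) = inj₂ (1̄·0·0·1 (Tail-++ z t))
  Forbidden-++ z (inj₂ (1̄·0·1̄ t)) = inj₂ (1̄·0·1̄ (Tail-++ z t))

  HasForbidden-++ : ∀ {w} z → HasForbidden w → HasForbidden (w ++ z)
  HasForbidden-++ z (here f) = here (Forbidden-++ z f)
  HasForbidden-++ z (there f) = there (HasForbidden-++ z f)

  Forbidden-nonempty : ∀ {w} → Forbidden w → w ≢ []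
  Forbidden-nonempty (inj₁ 1·1) ()
  Forbidden-nonempty (inj₁ 1·1̄) ()
  Forbidden-nonempty (inj₁ 1·0·1̄) ()
  Forbidden-nonempty (inj₁ (1·0·0·1̄ _)) ()
  Forbidden-nonempty (inj₁ (1·0·1 _)) ()
  Forbidden-nonempty (inj₂ 1̄·1̄) ()
  Forbidden-nonempty (inj₂ 1̄·1) ()
  Forbidden-nonempty (inj₂ 1̄·0·1) ()
  Forbidden-nonempty (inj₂ (1̄·0·0·1 _)) ()
  Forbidden-nonempty (inj₂ (1̄·0·1̄ _)) ()

  -- After appending a 0 the factor's tail ends in 0, so the improvement also preserves the β-value.
  hasForbidden⇒β-heavy : ∀ x → HasForbidden x → β-heavy x
  hasForbidden⇒β-heavy x f with split-at-forbidden (x ++ [0]) (HasForbidden-++ [0] f) Z0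
  ... | pre , a , w , eq , f′ with improve-forbidden a w f′
  ... | improvement v length≡ fval≡ weight< βval≡ = pre ++ v , (1 , 0 , βval≡′) , weight<′
    where
    ends : EndsWith0 w
    ends = endsWith0-tail (Forbidden-nonempty f′) (endsWith0-suffix pre (subst EndsWith0 eq (Z0 ∷ endsWith0-++-[0] x)))
    βval≡′ : mulβ (βval x) ≡ βval (pre ++ v)
    βval≡′ = sym (begin
      βval (pre ++ v)       ≡⟨ βval-++-cong pre length≡ (βval≡ ends) ⟩
      βval (pre ++ a ∷ w)   ≡⟨ cong βval eq ⟨
      βval (Z0 ∷ x ++ [0])  ≡⟨ βval-Z0∷ (x ++ [0]) ⟩
      βval (x ++ [0])       ≡⟨ βval-++-[0] x ⟩
      mulβ (βval x)         ∎)
      where open ≡-Reasoning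
    weight<′ : weight (pre ++ v) ℕ.< weight x
    weight<′ = subst (weight (pre ++ v) ℕ.<_) (trans (weight-++ x [0]) (ℕP.+-identityʳ (weight x))) (weight-split< pre eq weight<)

  Tail-++-[0]⁻ : ∀ {d} → d ≢ Z0 → ∀ w → Tail d (w ++ [0]) → Tail d w
  Tail-++-[0]⁻ d≢0 [] ()
  Tail-++-[0]⁻ d≢0 (_ ∷ []) 0·d = ⊥-elim (d≢0 refl)
  Tail-++-[0]⁻ d≢0 (_ ∷ _ ∷ []) 0·d = 0·d
  Tail-++-[0]⁻ d≢0 (_ ∷ _ ∷ []) 0·0·d = ⊥-elim (d≢0 refl)
  Tail-++-[0]⁻ d≢0 (_ ∷ _ ∷ _ ∷ []) 0·d = 0·d
  Tail-++-[0]⁻ d≢0 (_ ∷ _ ∷ _ ∷ []) 0·0·d = 0·0·d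
  Tail-++-[0]⁻ d≢0 (_ ∷ _ ∷ _ ∷ []) (0·0·0·d∷ _) = ⊥-elim (d≢0 refl)
  Tail-++-[0]⁻ d≢0 (_ ∷ _ ∷ _ ∷ _ ∷ _) 0·d = 0·d
  Tail-++-[0]⁻ d≢0 (_ ∷ _ ∷ _ ∷ _ ∷ _) 0·0·d = 0·0·d
  Tail-++-[0]⁻ d≢0 (_ ∷ _ ∷ _ ∷ _ ∷ w) (0·0·0·d∷ t) = 0·0·0·d∷ Tail-++-[0]⁻ d≢0 w t

  Forbidden⁺-++-[0]⁻ : ∀ w → Forbidden⁺ (w ++ [0]) → Forbidden⁺ w
  Forbidden⁺-++-[0]⁻ [] ()
  Forbidden⁺-++-[0]⁻ (_ ∷ []) ()
  Forbidden⁺-++-[0]⁻ (_ ∷ _ ∷ []) 1·1 = 1·1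
  Forbidden⁺-++-[0]⁻ (_ ∷ _ ∷ []) 1·1̄ = 1·1̄
  Forbidden⁺-++-[0]⁻ (_ ∷ _ ∷ _ ∷ []) 1·1 = 1·1
  Forbidden⁺-++-[0]⁻ (_ ∷ _ ∷ _ ∷ []) 1·1̄ = 1·1̄
  Forbidden⁺-++-[0]⁻ (_ ∷ _ ∷ _ ∷ []) 1·0·1̄ = 1·0·1̄
  Forbidden⁺-++-[0]⁻ (_ ∷ _ ∷ _ ∷ []) (1·0·1 t) = 1·0·1 (Tail-++-[0]⁻ (λ ()) [] t)
  Forbidden⁺-++-[0]⁻ (_ ∷ _ ∷ _ ∷ _ ∷ _) 1·1 = 1·1
  Forbidden⁺-++-[0]⁻ (_ ∷ _ ∷ _ ∷ _ ∷ _) 1·1̄ = 1·1̄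
  Forbidden⁺-++-[0]⁻ (_ ∷ _ ∷ _ ∷ _ ∷ _) 1·0·1̄ = 1·0·1̄
  Forbidden⁺-++-[0]⁻ (_ ∷ _ ∷ _ ∷ _ ∷ w) (1·0·0·1̄ t) = 1·0·0·1̄ (Tail-++-[0]⁻ (λ ()) w t)
  Forbidden⁺-++-[0]⁻ (_ ∷ _ ∷ _ ∷ d ∷ w) (1·0·1 t) = 1·0·1 (Tail-++-[0]⁻ (λ ()) (d ∷ w) t)

  Forbidden-++-[0]⁻ : ∀ w → Forbidden (w ++ [0]) → Forbidden w
  Forbidden-++-[0]⁻ w (inj₁ f) = inj₁ (Forbidden⁺-++-[0]⁻ w f)
  Forbidden-++-[0]⁻ w (inj₂ f) = inj₂ (subst Forbidden⁻ (negate-involutive w)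
    (Forbidden⁺-negate (Forbidden⁺-++-[0]⁻ (negate w) (subst Forbidden⁺ (map-++ (-_) w [0]) (Forbidden⁻-negate f)))))

  HasForbidden-++-[0]⁻ : ∀ w → HasForbidden (w ++ [0]) → HasForbidden w
  HasForbidden-++-[0]⁻ [] (here f) = here (Forbidden-++-[0]⁻ [] f)
  HasForbidden-++-[0]⁻ (a ∷ w) (here f) = here (Forbidden-++-[0]⁻ (a ∷ w) f)
  HasForbidden-++-[0]⁻ [] (there (here (inj₁ ())))
  HasForbidden-++-[0]⁻ [] (there (here (inj₂ ())))
  HasForbidden-++-[0]⁻ (_ ∷ w) (there f) = there (HasForbidden-++-[0]⁻ w f)

module LowerBound where
  open import Data.Nat as ℕ using (ℕ; zero; suc; z≤n; s≤s)
  import Data.Nat.Properties as ℕP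
  open import Data.Integer as ℤ using (+_; -[1+_]; _+_; _*_; -_; _-_)
  import Data.Integer.Properties as ℤP
  open import Data.Integer.Tactic.RingSolver
  open import Data.List using ([]; _∷_; length; _++_; replicate)
  open import Data.List.Properties using (length-map; length-replicate)
  open import Data.List.Relation.Unary.All using ([]; _∷_)
  open import Data.Product using (_×_; _,_; ∃; proj₁; proj₂)
  open import Data.Empty using (⊥-elim)
  open import Data.Sum using (inj₁; inj₂)
  open import Relation.Nullary using (¬_)
  open import Relation.Binary.PropositionalEquality
  open import Defs
  open Rewriting
  open ForbiddenFactors
  open Fibonacci
  open MinimalWeight
  open Lipschitz
  open IntegerWeight

  ForbiddenFree : Word → Set
  ForbiddenFree x = ¬ HasForbidden x

  ForbiddenFree-tail : ∀ {a x} → ForbiddenFree (a ∷ x) → ForbiddenFree x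
  ForbiddenFree-tail free b = free (there b)

  ForbiddenFree-negate : ∀ {x} → ForbiddenFree x → ForbiddenFree (negate x)
  ForbiddenFree-negate {x} free b = free (subst HasForbidden (negate-involutive x) (HasForbidden-negate b))

  Ternary-negate : ∀ {x} → Ternary x → Ternary (negate x)
  Ternary-negate [] = []
  Ternary-negate (inj₁ refl ∷ t) = inj₂ (inj₂ refl) ∷ Ternary-negate t
  Ternary-negate (inj₂ (inj₁ refl) ∷ t) = inj₂ (inj₁ refl) ∷ Ternary-negate t
  Ternary-negate (inj₂ (inj₂ refl) ∷ t) = inj₁ refl ∷ Ternary-negate t

  zeros : ℕ → Word
  zeros k = replicate k Z0

  fval-zeros-++ : ∀ k z → fval (zeros k ++ z) ≡ fval z
  fval-zeros-++ zero z = refl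
  fval-zeros-++ (suc k) z = trans (fval-Z0∷ (zeros k ++ z)) (fval-zeros-++ k z)

  length-zeros-++ : ∀ k z → length (zeros k ++ z) ≡ k ℕ.+ length z
  length-zeros-++ zero z = refl
  length-zeros-++ (suc k) z = cong suc (length-zeros-++ k z)

  ForbiddenFree-zeros-++ : ∀ k {z} → ForbiddenFree (zeros k ++ z) → ForbiddenFree z
  ForbiddenFree-zeros-++ zero free = free
  ForbiddenFree-zeros-++ (suc k) free = ForbiddenFree-zeros-++ k (ForbiddenFree-tail free)

  Ternary-tail : ∀ {a x} → Ternary (a ∷ x) → Ternary x
  Ternary-tail (_ ∷ t) = t

  Ternary-zeros-++ : ∀ k {z} → Ternary (zeros k ++ z) → Ternary z
  Ternary-zeros-++ zero t = t
  Ternary-zeros-++ (suc k) (_ ∷ t) = Ternary-zeros-++ k t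

  data Shape : Word → Set where
    zeros-only : ∀ k → Shape (zeros k)
    zeros-then-1 : ∀ k r → Shape (zeros k ++ P1 ∷ r)
    zeros-then-1̄ : ∀ k r → Shape (zeros k ++ N1 ∷ r)

  shape : ∀ r → Ternary r → Shape r
  shape [] [] = zeros-only 0
  shape (_ ∷ r) (inj₁ refl ∷ t) = zeros-then-1̄ 0 r
  shape (_ ∷ r) (inj₂ (inj₂ refl) ∷ t) = zeros-then-1 0 r
  shape (_ ∷ r) (inj₂ (inj₁ refl) ∷ t) with shape r t
  ... | zeros-only k = zeros-only (suc k)
  ... | zeros-then-1 k r′ = zeros-then-1 (suc k) r′
  ... | zeros-then-1̄ k r′ = zeros-then-1̄ (suc k) r′

  length-induction : (P : Word → Set) → (∀ x → (∀ y → length y ℕ.< length x → P y) → P x) → ∀ x → P x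
  length-induction P step x = below (suc (length x)) x ℕP.≤-refl
    where
    below : ∀ n x → length x ℕ.< n → P x
    below (suc n) x (s≤s x<n) = step x (λ y y<x → below n y (ℕP.≤-trans y<x x<n))

  fval-1∷ : ∀ r → fval (P1 ∷ r) ≡ F (length r) + fval r
  fval-1∷ r = cong (_+ fval r) (ℤP.*-identityˡ (F (length r)))

  fval-1̄∷ : ∀ r → fval (N1 ∷ r) ≡ - fval (P1 ∷ negate r)
  fval-1̄∷ r = trans (cong fval (cong (N1 ∷_) (sym (negate-involutive r)))) (fval-negate (P1 ∷ negate r))

  +≡⇒≡- : ∀ x y t → x + y ≡ t → y ≡ t - x
  +≡⇒≡- x y t refl = lemma x y
    where
    lemma : ∀ x y → y ≡ (x + y) - x
    lemma = solve-∀

  fval-zeros : ∀ k → fval (zeros k) ≡ + 0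
  fval-zeros zero = refl
  fval-zeros (suc k) = trans (fval-Z0∷ (zeros k)) (fval-zeros k)

  fval-1∷zeros : ∀ k → fval (P1 ∷ zeros k) ≡ + fib k
  fval-1∷zeros k =
    trans (fval-1∷ (zeros k)) (trans (cong₂ _+_ (trans (cong F (length-replicate k)) (F≡fib k)) (fval-zeros k)) (ℤP.+-identityʳ _))

  BoundedValue : Word → Set
  BoundedValue t = ∃ λ a → (fval (P1 ∷ t) ≡ + a) × (a ℕ.≤ fib (suc (length t)))

  value-bound : ∀ t → Ternary t → ForbiddenFree (P1 ∷ t) → BoundedValue t
  value-bound = length-induction (λ t → Ternary t → ForbiddenFree (P1 ∷ t) → BoundedValue t) step
    where
    step : ∀ t → (∀ y → length y ℕ.< length t → Ternary y → ForbiddenFree (P1 ∷ y) → BoundedValue y) →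
           Ternary t → ForbiddenFree (P1 ∷ t) → BoundedValue t
    step t IH tern free with shape t tern
    ... | zeros-only k = fib k , fval-1∷zeros k
                       , subst (λ n → fib k ℕ.≤ fib (suc n)) (sym (length-replicate k)) (ℕP.<⇒≤ (fib-<-suc k))
    ... | zeros-then-1 zero r = ⊥-elim (free (here (inj₁ 1·1)))
    ... | zeros-then-1 (suc k) r = fib L ℕ.+ a , fval≡ , bound
      where
      L = suc (k ℕ.+ suc (length r))
      length≡L : length (zeros (suc k) ++ P1 ∷ r) ≡ L
      length≡L = length-zeros-++ (suc k) (P1 ∷ r)
      shorter : length r ℕ.< length t
      shorter = subst (length r ℕ.<_) (sym length≡L) (ℕP.m≤n⇒m≤1+n (ℕP.m≤n+m (suc (length r)) k))
      IH′ = IH r shorter (Ternary-tail (Ternary-zeros-++ (suc k) tern)) (ForbiddenFree-zeros-++ (suc k) (ForbiddenFree-tail free))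
      a = proj₁ IH′
      fval≡ : fval (P1 ∷ zeros (suc k) ++ P1 ∷ r) ≡ + (fib L ℕ.+ a)
      fval≡ = trans (fval-1∷ (zeros (suc k) ++ P1 ∷ r))
                (cong₂ _+_ (trans (cong F length≡L) (F≡fib L)) (trans (fval-zeros-++ (suc k) (P1 ∷ r)) (proj₁ (proj₂ IH′))))
      bound : fib L ℕ.+ a ℕ.≤ fib (suc (length (zeros (suc k) ++ P1 ∷ r)))
      bound = subst (λ n → fib L ℕ.+ a ℕ.≤ fib (suc (suc n))) (sym (length-zeros-++ k (P1 ∷ r)))
                (ℕP.+-monoʳ-≤ (fib L) (ℕP.≤-trans (proj₂ (proj₂ IH′)) (fib-mono-≤ (ℕP.m≤n+m (suc (length r)) k))))
    ... | zeros-then-1̄ zero r = ⊥-elim (free (here (inj₁ 1·1̄)))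
    ... | zeros-then-1̄ (suc zero) r = ⊥-elim (free (here (inj₁ 1·0·1̄)))
    ... | zeros-then-1̄ (suc (suc k)) r =
      c , fval≡ , ℕP.≤-trans c≤F (subst (λ n → fib L ℕ.≤ fib (suc n)) (sym length≡L) (ℕP.<⇒≤ (fib-<-suc L)))
      where
      L = suc (suc (k ℕ.+ suc (length r)))
      length≡L : length (zeros (suc (suc k)) ++ N1 ∷ r) ≡ L
      length≡L = length-zeros-++ (suc (suc k)) (N1 ∷ r)
      shorter : length (negate r) ℕ.< length t
      shorter = subst₂ ℕ._<_ (sym (length-map (-_) r)) (sym length≡L) (ℕP.m≤n⇒m≤1+n (ℕP.m≤n⇒m≤1+n (ℕP.m≤n+m (suc (length r)) k)))
      IH′ = IH (negate r) shorter (Ternary-negate (Ternary-tail (Ternary-zeros-++ (suc (suc k)) tern)))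
              (ForbiddenFree-negate (ForbiddenFree-zeros-++ (suc (suc k)) (ForbiddenFree-tail free)))
      a = proj₁ IH′
      a≤F : a ℕ.≤ fib L
      a≤F = ℕP.≤-trans (proj₂ (proj₂ IH′))
              (fib-mono-≤ (ℕP.≤-trans (ℕP.≤-reflexive (cong suc (length-map (-_) r))) (ℕP.m≤n+m (suc (length r)) (suc (suc k)))))
      d = difference a≤F
      c = proj₁ d
      c≤F : c ℕ.≤ fib L
      c≤F = subst (c ℕ.≤_) (proj₂ d) (ℕP.m≤n+m c a)
      fval≡ : fval (P1 ∷ zeros (suc (suc k)) ++ N1 ∷ r) ≡ + c
      fval≡ = begin
        fval (P1 ∷ zeros (suc (suc k)) ++ N1 ∷ r)        ≡⟨ fval-1∷ (zeros (suc (suc k)) ++ N1 ∷ r) ⟩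
        F (length (zeros (suc (suc k)) ++ N1 ∷ r)) + fval (zeros (suc (suc k)) ++ N1 ∷ r)
          ≡⟨ cong₂ _+_ (trans (cong F length≡L) (trans (F≡fib L) (cong +_ (sym (proj₂ d)))))
                       (trans (fval-zeros-++ (suc (suc k)) (N1 ∷ r)) (trans (fval-1̄∷ r) (cong -_ (proj₁ (proj₂ IH′))))) ⟩
        (+ a + + c) + (- + a)                            ≡⟨ lemma (+ a) (+ c) ⟩
        + c                                              ∎
        where
        open ≡-Reasoning
        lemma : ∀ x y → (x + y) + (- x) ≡ y
        lemma = solve-∀

  BoundBelow : ℕ → Set
  BoundBelow n = ∀ y → length y ℕ.< n → Ternary y → ForbiddenFree y → weight y ℕ.≤ minWeightℤ (fval y)

  below⁺ : ∀ {n} → BoundBelow n → ∀ y {a} → length y ℕ.< n → Ternary y → ForbiddenFree y →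
    fval y ≡ + a → weight y ℕ.≤ minWeight a
  below⁺ IH y shorter tern free fval≡ = subst (λ z → weight y ℕ.≤ minWeightℤ z) fval≡ (IH y shorter tern free)

  below⁻ : ∀ {n} → BoundBelow n → ∀ y {a} → length y ℕ.< n → Ternary y → ForbiddenFree y →
    fval y ≡ - + a → weight y ℕ.≤ minWeight a
  below⁻ IH y {a} shorter tern free fval≡ =
    subst (weight y ℕ.≤_) (minWeightℤ-neg (+ a)) (subst (λ z → weight y ℕ.≤ minWeightℤ z) fval≡ (IH y shorter tern free))

  bound-by-split : ∀ r q a b → a ℕ.+ b ≡ fib q → fval (P1 ∷ r) ≡ + (fib (suc q) ℕ.+ a) →
    weight r ℕ.≤ minWeight a → weight r ℕ.≤ minWeight b → suc (weight r) ℕ.≤ minWeightℤ (fval (P1 ∷ r))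
  bound-by-split r q a b a+b≡F fval≡ wr≤Wa wr≤Wb =
    subst (λ z → suc (weight r) ℕ.≤ minWeightℤ z) (sym fval≡)
      (subst (suc (weight r) ℕ.≤_) (sym (minWeight-split (suc q) (fib (suc q) ℕ.+ a) a b refl F+a+b≡F))
        (s≤s (ℕP.⊓-glb wr≤Wa wr≤Wb)))
    where
    F+a+b≡F : fib (suc q) ℕ.+ a ℕ.+ b ≡ fib (suc (suc q))
    F+a+b≡F = trans (ℕP.+-assoc (fib (suc q)) a b) (cong (fib (suc q) ℕ.+_) a+b≡F)

  ForbiddenFree-1·0·1·0⇒1̄ : ∀ r″ → ForbiddenFree (P1 ∷ Z0 ∷ P1 ∷ Z0 ∷ r″) → ForbiddenFree (N1 ∷ r″)
  ForbiddenFree-1·0·1·0⇒1̄ r″ free (there b) = free (there (there (there (there b))))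
  ForbiddenFree-1·0·1·0⇒1̄ r″ free (here (inj₁ ()))
  ForbiddenFree-1·0·1·0⇒1̄ _ free (here (inj₂ 1̄·1̄)) = free (there (there (here (inj₁ 1·0·1̄))))
  ForbiddenFree-1·0·1·0⇒1̄ _ free (here (inj₂ 1̄·1)) = free (here (inj₁ (1·0·1 0·d)))
  ForbiddenFree-1·0·1·0⇒1̄ _ free (here (inj₂ 1̄·0·1)) = free (here (inj₁ (1·0·1 0·0·d)))
  ForbiddenFree-1·0·1·0⇒1̄ _ free (here (inj₂ (1̄·0·0·1 t))) = free (here (inj₁ (1·0·1 (0·0·0·d∷_ t))))
  ForbiddenFree-1·0·1·0⇒1̄ _ free (here (inj₂ (1̄·0·1̄ t))) = free (there (there (here (inj₁ (1·0·0·1̄ t)))))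

  ForbiddenFree-1·0·0·1⇒1̄·0 : ∀ r′ → ForbiddenFree (P1 ∷ Z0 ∷ Z0 ∷ P1 ∷ r′) → ForbiddenFree (N1 ∷ Z0 ∷ r′)
  ForbiddenFree-1·0·0·1⇒1̄·0 r′ free (there (there b)) = free (there (there (there (there b))))
  ForbiddenFree-1·0·0·1⇒1̄·0 r′ free (there (here (inj₁ ())))
  ForbiddenFree-1·0·0·1⇒1̄·0 r′ free (there (here (inj₂ ())))
  ForbiddenFree-1·0·0·1⇒1̄·0 r′ free (here (inj₁ ()))
  ForbiddenFree-1·0·0·1⇒1̄·0 _ free (here (inj₂ 1̄·0·1)) = free (there (there (there (here (inj₁ 1·1)))))
  ForbiddenFree-1·0·0·1⇒1̄·0 _ free (here (inj₂ (1̄·0·0·1 t))) = free (there (there (there (here (inj₁ (1·0·1 t))))))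
  ForbiddenFree-1·0·0·1⇒1̄·0 _ free (here (inj₂ (1̄·0·1̄ t))) = free (there (there (there (here (inj₁ 1·1̄)))))

  ForbiddenFree-1·0·0·1̄·0⇒1 : ∀ r″ → ForbiddenFree (P1 ∷ Z0 ∷ Z0 ∷ N1 ∷ Z0 ∷ r″) → ForbiddenFree (P1 ∷ r″)
  ForbiddenFree-1·0·0·1̄·0⇒1 r″ free (there b) = free (there (there (there (there (there b)))))
  ForbiddenFree-1·0·0·1̄·0⇒1 r″ free (here (inj₂ ()))
  ForbiddenFree-1·0·0·1̄·0⇒1 _ free (here (inj₁ 1·1)) = free (there (there (there (here (inj₂ 1̄·0·1)))))
  ForbiddenFree-1·0·0·1̄·0⇒1 _ free (here (inj₁ 1·1̄)) = free (here (inj₁ (1·0·0·1̄ 0·d)))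
  ForbiddenFree-1·0·0·1̄·0⇒1 _ free (here (inj₁ 1·0·1̄)) = free (here (inj₁ (1·0·0·1̄ 0·0·d)))
  ForbiddenFree-1·0·0·1̄·0⇒1 _ free (here (inj₁ (1·0·0·1̄ t))) = free (here (inj₁ (1·0·0·1̄ (0·0·0·d∷_ t))))
  ForbiddenFree-1·0·0·1̄·0⇒1 _ free (here (inj₁ (1·0·1 t))) = free (there (there (there (here (inj₂ (1̄·0·0·1 t))))))

  ForbiddenFree-1·0·0·0·1̄⇒1·0 : ∀ r′ → ForbiddenFree (P1 ∷ Z0 ∷ Z0 ∷ Z0 ∷ N1 ∷ r′) → ForbiddenFree (P1 ∷ Z0 ∷ r′)
  ForbiddenFree-1·0·0·0·1̄⇒1·0 r′ free (there (there b)) = free (there (there (there (there (there b)))))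
  ForbiddenFree-1·0·0·0·1̄⇒1·0 r′ free (there (here (inj₁ ())))
  ForbiddenFree-1·0·0·0·1̄⇒1·0 r′ free (there (here (inj₂ ())))
  ForbiddenFree-1·0·0·0·1̄⇒1·0 r′ free (here (inj₂ ()))
  ForbiddenFree-1·0·0·0·1̄⇒1·0 _ free (here (inj₁ 1·0·1̄)) = free (there (there (there (there (here (inj₂ 1̄·1̄))))))
  ForbiddenFree-1·0·0·0·1̄⇒1·0 _ free (here (inj₁ (1·0·0·1̄ t))) = free (there (there (there (there (here (inj₂ (1̄·0·1̄ t)))))))
  ForbiddenFree-1·0·0·0·1̄⇒1·0 _ free (here (inj₁ (1·0·1 t))) = free (there (there (there (there (here (inj₂ 1̄·1))))))

  bound-1·0·1-complement : ∀ r → Ternary r → ForbiddenFree (P1 ∷ Z0 ∷ P1 ∷ r) → BoundBelow (3 ℕ.+ length r) →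
    ∀ a b → fval (P1 ∷ r) ≡ + a → + b ≡ + fib (suc (length r)) - + a → suc (weight r) ℕ.≤ minWeight b
  bound-1·0·1-complement [] tern free IH a b fval≡a b≡F-a with ℤP.+-injective (sym fval≡a)
  ... | refl with ℤP.+-injective b≡F-a
  ... | refl = ℕP.≤-refl
  bound-1·0·1-complement (_ ∷ r) (inj₂ (inj₂ refl) ∷ tern) free IH a b fval≡a b≡F-a = ⊥-elim (free (there (there (here (inj₁ 1·1)))))
  bound-1·0·1-complement (_ ∷ r) (inj₁ refl ∷ tern) free IH a b fval≡a b≡F-a = ⊥-elim (free (there (there (here (inj₁ 1·1̄)))))
  bound-1·0·1-complement (_ ∷ r) (inj₂ (inj₁ refl) ∷ tern) free IH a b fval≡a b≡F-a =
    below⁻ IH (N1 ∷ r) (s≤s (ℕP.m≤n+m (suc (length r)) 2)) (inj₁ refl ∷ tern) (ForbiddenFree-1·0·1·0⇒1̄ r free) fval≡b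
    where
    n = length r
    lemma : ∀ x y ρ → - ((x + y) - (+ 1 * x + (+ 0 * y + ρ))) ≡ -[1+ 0 ] * y + ρ
    lemma = solve-∀
    fval≡b : fval (N1 ∷ r) ≡ - + b
    fval≡b = sym (trans (cong -_ b≡F-a)
               (trans (cong₂ (λ u v → - (u - v)) (sym (F≡fib (suc (suc n)))) (sym fval≡a)) (lemma (F (suc n)) (F n) (fval r))))

  bound-1·0·1 : ∀ r → Ternary r → ForbiddenFree (P1 ∷ Z0 ∷ P1 ∷ r) → BoundBelow (3 ℕ.+ length r) →
    suc (weight (Z0 ∷ P1 ∷ r)) ℕ.≤ minWeightℤ (fval (P1 ∷ Z0 ∷ P1 ∷ r))
  bound-1·0·1 r tern free IH = bound-by-split (Z0 ∷ P1 ∷ r) q a b a+b≡F fval≡ wr≤Wa wr≤Wb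
    where
    q = suc (length r)
    bounded = value-bound r tern (ForbiddenFree-tail (ForbiddenFree-tail free))
    a = proj₁ bounded
    fval≡a = proj₁ (proj₂ bounded)
    db = difference (proj₂ (proj₂ bounded))
    b = proj₁ db
    a+b≡F = proj₂ db
    fval≡ : fval (P1 ∷ Z0 ∷ P1 ∷ r) ≡ + (fib (suc q) ℕ.+ a)
    fval≡ = trans (fval-1∷ (Z0 ∷ P1 ∷ r)) (cong₂ _+_ (F≡fib (suc q)) (trans (fval-Z0∷ (P1 ∷ r)) fval≡a))
    wr≤Wa : weight (Z0 ∷ P1 ∷ r) ℕ.≤ minWeight a
    wr≤Wa = below⁺ IH (Z0 ∷ P1 ∷ r) ℕP.≤-refl (inj₂ (inj₁ refl) ∷ inj₂ (inj₂ refl) ∷ tern) (ForbiddenFree-tail free)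
              (trans (fval-Z0∷ (P1 ∷ r)) fval≡a)
    wr≤Wb : weight (Z0 ∷ P1 ∷ r) ℕ.≤ minWeight b
    wr≤Wb = bound-1·0·1-complement r tern free IH a b fval≡a (+≡⇒≡- (+ a) (+ b) (+ fib q) (cong +_ a+b≡F))

  bound-1·0·0·1 : ∀ r → Ternary r → ForbiddenFree (P1 ∷ Z0 ∷ Z0 ∷ P1 ∷ r) → BoundBelow (4 ℕ.+ length r) →
    suc (weight (Z0 ∷ Z0 ∷ P1 ∷ r)) ℕ.≤ minWeightℤ (fval (P1 ∷ Z0 ∷ Z0 ∷ P1 ∷ r))
  bound-1·0·0·1 r tern free IH = bound-by-split (Z0 ∷ Z0 ∷ P1 ∷ r) q a b a+b≡F fval≡ wr≤Wa wr≤Wb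
    where
    p = length r
    q = suc (suc p)
    bounded = value-bound r tern (ForbiddenFree-tail (ForbiddenFree-tail (ForbiddenFree-tail free)))
    a = proj₁ bounded
    fval≡a = proj₁ (proj₂ bounded)
    db = difference (ℕP.≤-trans (proj₂ (proj₂ bounded)) (ℕP.<⇒≤ (fib-<-suc (suc p))))
    b = proj₁ db
    a+b≡F = proj₂ db
    fval≡ : fval (P1 ∷ Z0 ∷ Z0 ∷ P1 ∷ r) ≡ + (fib (suc q) ℕ.+ a)
    fval≡ = trans (fval-1∷ (Z0 ∷ Z0 ∷ P1 ∷ r)) (cong₂ _+_ (F≡fib (suc q)) (trans (fval-zeros-++ 2 (P1 ∷ r)) fval≡a))
    wr≤Wa : weight (Z0 ∷ Z0 ∷ P1 ∷ r) ℕ.≤ minWeight a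
    wr≤Wa = below⁺ IH (Z0 ∷ Z0 ∷ P1 ∷ r) ℕP.≤-refl (inj₂ (inj₁ refl) ∷ inj₂ (inj₁ refl) ∷ inj₂ (inj₂ refl) ∷ tern)
              (ForbiddenFree-tail free) (trans (fval-zeros-++ 2 (P1 ∷ r)) fval≡a)
    lemma : ∀ x y ρ → - ((x + y) - (+ 1 * y + ρ)) ≡ -[1+ 0 ] * x + (+ 0 * y + ρ)
    lemma = solve-∀
    fval≡b : fval (N1 ∷ Z0 ∷ r) ≡ - + b
    fval≡b = sym (trans (cong -_ (+≡⇒≡- (+ a) (+ b) (+ fib q) (cong +_ a+b≡F)))
               (trans (cong₂ (λ u v → - (u - v)) (sym (F≡fib q)) (sym fval≡a)) (lemma (F (suc p)) (F p) (fval r))))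
    wr≤Wb : weight (Z0 ∷ Z0 ∷ P1 ∷ r) ℕ.≤ minWeight b
    wr≤Wb = below⁻ IH (N1 ∷ Z0 ∷ r) (s≤s (ℕP.n≤1+n (suc (suc p)))) (inj₁ refl ∷ inj₂ (inj₁ refl) ∷ tern)
              (ForbiddenFree-1·0·0·1⇒1̄·0 r free) fval≡b

  fval-1∷negate : ∀ r → fval (P1 ∷ negate r) ≡ F (length r) + - fval r
  fval-1∷negate r = trans (fval-1∷ (negate r)) (cong₂ _+_ (cong F (length-map (-_) r)) (fval-negate r))

  bound-1·0·0·1̄-complement : ∀ r → Ternary r → ForbiddenFree (P1 ∷ Z0 ∷ Z0 ∷ N1 ∷ r) → BoundBelow (4 ℕ.+ length r) →
    ∀ a b → fval (P1 ∷ negate r) ≡ + a → + b ≡ + fib (suc (length r)) - + a → suc (weight r) ℕ.≤ minWeight b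
  bound-1·0·0·1̄-complement [] tern free IH a b fval≡a b≡F-a with ℤP.+-injective (sym fval≡a)
  ... | refl with ℤP.+-injective b≡F-a
  ... | refl = ℕP.≤-refl
  bound-1·0·0·1̄-complement (_ ∷ r) (inj₂ (inj₂ refl) ∷ tern) free IH a b fval≡a b≡F-a = ⊥-elim (free (there (there (there (here (inj₂ 1̄·1))))))
  bound-1·0·0·1̄-complement (_ ∷ r) (inj₁ refl ∷ tern) free IH a b fval≡a b≡F-a = ⊥-elim (free (there (there (there (here (inj₂ 1̄·1̄))))))
  bound-1·0·0·1̄-complement (_ ∷ r) (inj₂ (inj₁ refl) ∷ tern) free IH a b fval≡a b≡F-a =
    below⁺ IH (P1 ∷ r) (s≤s (ℕP.m≤n+m (suc (length r)) 3)) (inj₂ (inj₂ refl) ∷ tern) (ForbiddenFree-1·0·0·1̄·0⇒1 r free) fval≡b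
    where
    n = length r
    lemma : ∀ x y ρ → (x + y) - (x + - ρ) ≡ + 1 * y + ρ
    lemma = solve-∀
    a≡ : + a ≡ F (suc n) + - fval r
    a≡ = trans (sym fval≡a) (trans (fval-1∷ (Z0 ∷ negate r))
           (cong₂ _+_ (cong (λ m → F (suc m)) (length-map (-_) r)) (trans (fval-Z0∷ (negate r)) (fval-negate r))))
    fval≡b : fval (P1 ∷ r) ≡ + b
    fval≡b = sym (trans b≡F-a (trans (cong₂ _-_ (sym (F≡fib (suc (suc n)))) a≡) (lemma (F (suc n)) (F n) (fval r))))

  fval-1∷-negative : ∀ r q {a b} → length r ≡ suc (suc q) → fval r ≡ - + a → + b ≡ + fib q - + a →
    fval (P1 ∷ r) ≡ + (fib (suc q) ℕ.+ b)
  fval-1∷-negative r q {a} {b} length≡ fval≡r b≡F-a =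
    trans (fval-1∷ r)
      (trans (cong₂ _+_ (trans (cong F length≡) (cong₂ _+_ (F≡fib (suc q)) (F≡fib q))) fval≡r)
        (trans (lemma (+ fib (suc q)) (+ fib q) (+ a)) (cong (λ t → + fib (suc q) + t) (sym b≡F-a))))
    where
    lemma : ∀ x y z → (x + y) + - z ≡ x + (y - z)
    lemma = solve-∀

  bound-1·0·0·1̄ : ∀ r → Ternary r → ForbiddenFree (P1 ∷ Z0 ∷ Z0 ∷ N1 ∷ r) → BoundBelow (4 ℕ.+ length r) →
    suc (weight (Z0 ∷ Z0 ∷ N1 ∷ r)) ℕ.≤ minWeightℤ (fval (P1 ∷ Z0 ∷ Z0 ∷ N1 ∷ r))
  bound-1·0·0·1̄ r tern free IH = bound-by-split (Z0 ∷ Z0 ∷ N1 ∷ r) q b a (trans (ℕP.+-comm b a) a+b≡F) fval≡ wr≤Wb wr≤Wa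
    where
    q = suc (length r)
    bounded = value-bound (negate r) (Ternary-negate tern)
                (ForbiddenFree-negate (ForbiddenFree-tail (ForbiddenFree-tail (ForbiddenFree-tail free))))
    a = proj₁ bounded
    fval≡a = proj₁ (proj₂ bounded)
    db = difference (subst (λ m → a ℕ.≤ fib (suc m)) (length-map (-_) r) (proj₂ (proj₂ bounded)))
    b = proj₁ db
    a+b≡F = proj₂ db
    b≡F-a : + b ≡ + fib q - + a
    b≡F-a = +≡⇒≡- (+ a) (+ b) (+ fib q) (cong +_ a+b≡F)
    fval≡r : fval (Z0 ∷ Z0 ∷ N1 ∷ r) ≡ - + a
    fval≡r = trans (fval-zeros-++ 2 (N1 ∷ r)) (trans (fval-1̄∷ r) (cong -_ fval≡a))
    fval≡ : fval (P1 ∷ Z0 ∷ Z0 ∷ N1 ∷ r) ≡ + (fib (suc q) ℕ.+ b)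
    fval≡ = fval-1∷-negative (Z0 ∷ Z0 ∷ N1 ∷ r) q refl fval≡r b≡F-a
    wr≤Wa : weight (Z0 ∷ Z0 ∷ N1 ∷ r) ℕ.≤ minWeight a
    wr≤Wa = below⁻ IH (Z0 ∷ Z0 ∷ N1 ∷ r) ℕP.≤-refl (inj₂ (inj₁ refl) ∷ inj₂ (inj₁ refl) ∷ inj₁ refl ∷ tern)
              (ForbiddenFree-tail free) fval≡r
    wr≤Wb : weight (Z0 ∷ Z0 ∷ N1 ∷ r) ℕ.≤ minWeight b
    wr≤Wb = bound-1·0·0·1̄-complement r tern free IH a b fval≡a b≡F-a

  bound-1·0·0·0·1̄ : ∀ r → Ternary r → ForbiddenFree (P1 ∷ Z0 ∷ Z0 ∷ Z0 ∷ N1 ∷ r) → BoundBelow (5 ℕ.+ length r) →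
    suc (weight (Z0 ∷ Z0 ∷ Z0 ∷ N1 ∷ r)) ℕ.≤ minWeightℤ (fval (P1 ∷ Z0 ∷ Z0 ∷ Z0 ∷ N1 ∷ r))
  bound-1·0·0·0·1̄ r tern free IH = bound-by-split (Z0 ∷ Z0 ∷ Z0 ∷ N1 ∷ r) q b a (trans (ℕP.+-comm b a) a+b≡F) fval≡ wr≤Wb wr≤Wa
    where
    p = length r
    q = suc (suc p)
    bounded = value-bound (negate r) (Ternary-negate tern)
                (ForbiddenFree-negate (ForbiddenFree-tail (ForbiddenFree-tail (ForbiddenFree-tail (ForbiddenFree-tail free)))))
    a = proj₁ bounded
    fval≡a = proj₁ (proj₂ bounded)
    db = difference (ℕP.≤-trans (subst (λ m → a ℕ.≤ fib (suc m)) (length-map (-_) r) (proj₂ (proj₂ bounded)))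
                                (ℕP.<⇒≤ (fib-<-suc (suc p))))
    b = proj₁ db
    a+b≡F = proj₂ db
    b≡F-a : + b ≡ + fib q - + a
    b≡F-a = +≡⇒≡- (+ a) (+ b) (+ fib q) (cong +_ a+b≡F)
    fval≡r : fval (Z0 ∷ Z0 ∷ Z0 ∷ N1 ∷ r) ≡ - + a
    fval≡r = trans (fval-zeros-++ 3 (N1 ∷ r)) (trans (fval-1̄∷ r) (cong -_ fval≡a))
    fval≡ : fval (P1 ∷ Z0 ∷ Z0 ∷ Z0 ∷ N1 ∷ r) ≡ + (fib (suc q) ℕ.+ b)
    fval≡ = fval-1∷-negative (Z0 ∷ Z0 ∷ Z0 ∷ N1 ∷ r) q refl fval≡r b≡F-a
    wr≤Wa : weight (Z0 ∷ Z0 ∷ Z0 ∷ N1 ∷ r) ℕ.≤ minWeight a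
    wr≤Wa = below⁻ IH (Z0 ∷ Z0 ∷ Z0 ∷ N1 ∷ r) ℕP.≤-refl (inj₂ (inj₁ refl) ∷ inj₂ (inj₁ refl) ∷ inj₂ (inj₁ refl) ∷ inj₁ refl ∷ tern)
              (ForbiddenFree-tail free) fval≡r
    lemma : ∀ x y ρ → (x + y) - (y + - ρ) ≡ + 1 * x + (+ 0 * y + ρ)
    lemma = solve-∀
    fval≡b : fval (P1 ∷ Z0 ∷ r) ≡ + b
    fval≡b = sym (trans b≡F-a (trans (cong₂ _-_ (sym (F≡fib q)) (trans (sym fval≡a) (fval-1∷negate r)))
                                      (lemma (F (suc p)) (F p) (fval r))))
    wr≤Wb : weight (Z0 ∷ Z0 ∷ Z0 ∷ N1 ∷ r) ℕ.≤ minWeight b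
    wr≤Wb = below⁺ IH (P1 ∷ Z0 ∷ r) (s≤s (ℕP.m≤n+m (suc (suc p)) 2)) (inj₂ (inj₂ refl) ∷ inj₂ (inj₁ refl) ∷ tern)
              (ForbiddenFree-1·0·0·0·1̄⇒1·0 r free) fval≡b

  ≤-complement : ∀ k p {a b} → a ℕ.+ b ≡ fib (suc (suc (k ℕ.+ suc p))) → a ℕ.≤ fib (suc p) → a ℕ.≤ b
  ≤-complement k p {a} {b} a+b≡F a≤F =
    ℕP.+-cancelˡ-≤ a a b (subst (a ℕ.+ a ℕ.≤_) (sym a+b≡F) (ℕP.≤-trans (ℕP.+-mono-≤ a≤F a≤F) (fib-+-fib≤fib-suc-suc k p)))

  -- After at least three zeros the complement b = F_q − a exceeds a, so minWeight b ≥ minWeight a.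
  bound-1·0ᵏ·1 : ∀ k r → let x = zeros (3 ℕ.+ k) ++ P1 ∷ r in
    Ternary x → ForbiddenFree (P1 ∷ x) → BoundBelow (suc (length x)) → suc (weight x) ℕ.≤ minWeightℤ (fval (P1 ∷ x))
  bound-1·0ᵏ·1 k r tern free IH = bound-by-split x q a b a+b≡F fval≡ wr≤Wa wr≤Wb
    where
    x = zeros (3 ℕ.+ k) ++ P1 ∷ r
    p = length r
    q = suc (suc (k ℕ.+ suc p))
    bounded = value-bound r (Ternary-tail (Ternary-zeros-++ (3 ℕ.+ k) tern)) (ForbiddenFree-zeros-++ (3 ℕ.+ k) (ForbiddenFree-tail free))
    a = proj₁ bounded
    a≤F = proj₂ (proj₂ bounded)
    db = difference (ℕP.≤-trans a≤F (fib-mono-≤ (ℕP.m≤n⇒m≤1+n (ℕP.m≤n⇒m≤1+n (ℕP.m≤n+m (suc p) k)))))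
    b = proj₁ db
    a+b≡F = proj₂ db
    fval≡x : fval x ≡ + a
    fval≡x = trans (fval-zeros-++ (3 ℕ.+ k) (P1 ∷ r)) (proj₁ (proj₂ bounded))
    fval≡ : fval (P1 ∷ x) ≡ + (fib (suc q) ℕ.+ a)
    fval≡ = trans (fval-1∷ x) (cong₂ _+_ (trans (cong F (length-zeros-++ (3 ℕ.+ k) (P1 ∷ r))) (F≡fib (suc q))) fval≡x)
    wr≤Wa : weight x ℕ.≤ minWeight a
    wr≤Wa = below⁺ IH x ℕP.≤-refl tern (ForbiddenFree-tail free) fval≡x
    wr≤Wb : weight x ℕ.≤ minWeight b
    wr≤Wb = ℕP.≤-trans wr≤Wa (minWeight-mono-complement q a b a+b≡F (≤-complement k p a+b≡F a≤F))

  bound-1·0ᵏ·1̄ : ∀ k r → let x = zeros (4 ℕ.+ k) ++ N1 ∷ r in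
    Ternary x → ForbiddenFree (P1 ∷ x) → BoundBelow (suc (length x)) → suc (weight x) ℕ.≤ minWeightℤ (fval (P1 ∷ x))
  bound-1·0ᵏ·1̄ k r tern free IH = bound-by-split x q b a (trans (ℕP.+-comm b a) a+b≡F) fval≡ wr≤Wb wr≤Wa
    where
    x = zeros (4 ℕ.+ k) ++ N1 ∷ r
    p = length r
    q = suc (suc (k ℕ.+ suc p))
    bounded = value-bound (negate r) (Ternary-negate (Ternary-tail (Ternary-zeros-++ (4 ℕ.+ k) tern)))
                (ForbiddenFree-negate (ForbiddenFree-zeros-++ (4 ℕ.+ k) (ForbiddenFree-tail free)))
    a = proj₁ bounded
    a≤F : a ℕ.≤ fib (suc p)
    a≤F = subst (λ m → a ℕ.≤ fib (suc m)) (length-map (-_) r) (proj₂ (proj₂ bounded))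
    db = difference (ℕP.≤-trans a≤F (fib-mono-≤ (ℕP.m≤n⇒m≤1+n (ℕP.m≤n⇒m≤1+n (ℕP.m≤n+m (suc p) k)))))
    b = proj₁ db
    a+b≡F = proj₂ db
    fval≡x : fval x ≡ - + a
    fval≡x = trans (fval-zeros-++ (4 ℕ.+ k) (N1 ∷ r)) (trans (fval-1̄∷ r) (cong -_ (proj₁ (proj₂ bounded))))
    fval≡ : fval (P1 ∷ x) ≡ + (fib (suc q) ℕ.+ b)
    fval≡ = fval-1∷-negative x q (length-zeros-++ (4 ℕ.+ k) (N1 ∷ r)) fval≡x (+≡⇒≡- (+ a) (+ b) (+ fib q) (cong +_ a+b≡F))
    wr≤Wa : weight x ℕ.≤ minWeight a
    wr≤Wa = below⁻ IH x ℕP.≤-refl tern (ForbiddenFree-tail free) fval≡x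
    wr≤Wb : weight x ℕ.≤ minWeight b
    wr≤Wb = ℕP.≤-trans wr≤Wa (minWeight-mono-complement q a b a+b≡F (≤-complement k p a+b≡F a≤F))

  weight-zeros : ∀ k → weight (zeros k) ≡ 0
  weight-zeros zero = refl
  weight-zeros (suc k) = weight-zeros k

  bound-1∷ : ∀ r → Ternary r → ForbiddenFree (P1 ∷ r) → BoundBelow (suc (length r)) →
    suc (weight r) ℕ.≤ minWeightℤ (fval (P1 ∷ r))
  bound-1∷ r tern free IH with shape r tern
  ... | zeros-only k = subst₂ (λ u z → suc u ℕ.≤ minWeightℤ z) (sym (weight-zeros k)) (sym (fval-1∷zeros k))
                         (ℕP.≤-reflexive (sym (minWeight-fib k)))
  ... | zeros-then-1 zero r′ = ⊥-elim (free (here (inj₁ 1·1)))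
  ... | zeros-then-1 (suc zero) r′ = bound-1·0·1 r′ (Ternary-tail (Ternary-tail tern)) free IH
  ... | zeros-then-1 (suc (suc zero)) r′ = bound-1·0·0·1 r′ (Ternary-tail (Ternary-tail (Ternary-tail tern))) free IH
  ... | zeros-then-1 (suc (suc (suc k))) r′ = bound-1·0ᵏ·1 k r′ tern free IH
  ... | zeros-then-1̄ zero r′ = ⊥-elim (free (here (inj₁ 1·1̄)))
  ... | zeros-then-1̄ (suc zero) r′ = ⊥-elim (free (here (inj₁ 1·0·1̄)))
  ... | zeros-then-1̄ (suc (suc zero)) r′ = bound-1·0·0·1̄ r′ (Ternary-tail (Ternary-tail (Ternary-tail tern))) free IH
  ... | zeros-then-1̄ (suc (suc (suc zero))) r′ = bound-1·0·0·0·1̄ r′ (Ternary-tail (Ternary-tail (Ternary-tail (Ternary-tail tern)))) free IH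
  ... | zeros-then-1̄ (suc (suc (suc (suc k)))) r′ = bound-1·0ᵏ·1̄ k r′ tern free IH

  weight≤minWeight-fval : ∀ x → Ternary x → ForbiddenFree x → weight x ℕ.≤ minWeightℤ (fval x)
  weight≤minWeight-fval = length-induction (λ x → Ternary x → ForbiddenFree x → weight x ℕ.≤ minWeightℤ (fval x)) step
    where
    step : ∀ x → BoundBelow (length x) → Ternary x → ForbiddenFree x → weight x ℕ.≤ minWeightℤ (fval x)
    step [] IH _ _ = z≤n
    step (_ ∷ x) IH (inj₂ (inj₁ refl) ∷ tern) free =
      subst (λ z → weight x ℕ.≤ minWeightℤ z) (sym (fval-Z0∷ x)) (IH x ℕP.≤-refl tern (ForbiddenFree-tail free))
    step (_ ∷ x) IH (inj₂ (inj₂ refl) ∷ tern) free = bound-1∷ x tern free IH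
    step (_ ∷ x) IH (inj₁ refl ∷ tern) free =
      subst₂ (λ u z → suc u ℕ.≤ z) (weight-negate x)
        (trans (sym (minWeightℤ-neg (fval (P1 ∷ negate x)))) (cong minWeightℤ (sym (fval-1̄∷ x))))
        (bound-1∷ (negate x) (Ternary-negate tern) (ForbiddenFree-negate free)
          (λ y shorter → IH y (subst (λ m → length y ℕ.< suc m) (length-map (-_) x) shorter)))

  forbiddenFree⇒F-minimal : ∀ x → Ternary x → ForbiddenFree x → F-minimal x
  forbiddenFree⇒F-minimal x tern free (y , fval≡ , lighter) = ℕP.<⇒≱ lighter (begin
    weight x            ≤⟨ weight≤minWeight-fval x tern free ⟩
    minWeightℤ (fval x) ≡⟨ cong minWeightℤ fval≡ ⟩
    minWeightℤ (fval y) ≤⟨ minWeight-fval≤weight y ⟩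
    weight y            ∎)
    where open ℕP.≤-Reasoning


module Padding where
  open import Data.Nat as ℕ using (ℕ; zero; suc)
  import Data.Nat.Properties as ℕP
  open import Data.List using (_∷_; []; _++_)
  open import Data.List.Relation.Unary.All using ([]; _∷_)
  open import Data.Product using (_,_; ∃)
  open import Data.Sum using (inj₁; inj₂)
  open import Relation.Binary.PropositionalEquality
  open import Defs
  open Rewriting
  open ForbiddenFactors

  appendZeros : ℕ → Word → Word
  appendZeros zero x = x
  appendZeros (suc p) x = appendZeros p x ++ [0]

  HasForbidden-appendZeros⁻ : ∀ p x → HasForbidden (appendZeros p x) → HasForbidden x
  HasForbidden-appendZeros⁻ zero x f = f
  HasForbidden-appendZeros⁻ (suc p) x f = HasForbidden-appendZeros⁻ p x (HasForbidden-++-[0]⁻ (appendZeros p x) f)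

  βval-appendZeros : ∀ p x → βval (appendZeros p x) ≡ mulβ^ p (βval x)
  βval-appendZeros zero x = refl
  βval-appendZeros (suc p) x = trans (βval-++-[0] (appendZeros p x)) (cong mulβ (βval-appendZeros p x))

  weight-appendZeros : ∀ p x → weight (appendZeros p x) ≡ weight x
  weight-appendZeros zero x = refl
  weight-appendZeros (suc p) x =
    trans (weight-++ (appendZeros p x) [0]) (trans (ℕP.+-identityʳ _) (weight-appendZeros p x))

  Ternary-++-[0] : ∀ {x} → Ternary x → Ternary (x ++ [0])
  Ternary-++-[0] [] = inj₂ (inj₁ refl) ∷ []
  Ternary-++-[0] (d ∷ t) = d ∷ Ternary-++-[0] t

  Ternary-appendZeros : ∀ p {x} → Ternary x → Ternary (appendZeros p x)
  Ternary-appendZeros zero t = t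
  Ternary-appendZeros (suc p) t = Ternary-++-[0] (Ternary-appendZeros p t)

  -- Multiplying by β^p is appending p zeros, after which equal β-values give equal F-values.
  β-heavy⇒F-heavy-appendZeros : ∀ x → β-heavy x → ∃ λ p → F-heavy (appendZeros p x)
  β-heavy⇒F-heavy-appendZeros x (y , (p , q , βval≡) , weight<) = p , appendZeros q y , fval≡ , weight<′
    where
    fval≡ : fval (appendZeros p x) ≡ fval (appendZeros q y)
    fval≡ = fval≡-from-βval≡ (appendZeros p x) (appendZeros q y)
              (trans (βval-appendZeros p x) (trans βval≡ (sym (βval-appendZeros q y))))
    weight<′ : weight (appendZeros q y) ℕ.< weight (appendZeros p x)
    weight<′ = subst₂ ℕ._<_ (sym (weight-appendZeros q y)) (sym (weight-appendZeros p x)) weight<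



open ForbiddenFactors
open LowerBound
open Padding

mainTheorem10 : (x : Word) → Ternary x →
    (F-minimal x → β-minimal x) × (β-minimal x → F-minimal x)
mainTheorem10 x t = F-minimal⇒β-minimal , β-minimal⇒F-minimal
  where
  F-minimal⇒β-minimal : F-minimal x → β-minimal x
  F-minimal⇒β-minimal F-min heavy with β-heavy⇒F-heavy-appendZeros x heavy
  ... | p , heavy′ = forbiddenFree⇒F-minimal (appendZeros p x) (Ternary-appendZeros p t)
                        (λ f → F-min (hasForbidden⇒F-heavy x (HasForbidden-appendZeros⁻ p x f))) heavy′
  β-minimal⇒F-minimal : β-minimal x → F-minimal x
  β-minimal⇒F-minimal β-min = forbiddenFree⇒F-minimal x t (λ f → β-min (hasForbidden⇒β-heavy x f))
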